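{- Fix integers $2\le r\le k$. There is a constant $c=c(k,r)>0$ such that the following holds. Let $H$ be an $n$-vertex, $m$-edge $k$-uniform multihypergraph and let $U\subseteq V(H)$ with $|U|=n-b$. Then either at least $cm$ edges of $H$ have at least $k-1$ of their vertices in $U$, or $b>0$ and $H$ has an $r$-cut with excess at least $cm/b$.
   Context: A $k$-uniform multihypergraph has a vertex set and a multiset of $k$-element vertex subsets (edges). An $r$-cut is a partition of $V(H)$ into $r$ labelled parts; its size is the number of edges (with multiplicity) having a vertex in every part; its excess is its size minus $\frac{S(k,r)r!}{r^k}m$, where $S(k,r)$ is the Stirling number of the second kind. -}

module Defs where

open import Data.Nat using (ℕ; zero; suc; _+_; _*_; _∸_; _^_; _≤ᵇ_; NonZero; _!)
open import Data.Nat.Properties using (m^n≢0)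
open import Data.Integer using (+_)
open import Data.Rational using (ℚ; _/_; _-_)
open import Data.Bool using (Bool; true; false; _∧_; if_then_else_)
open import Data.Fin using (Fin; _≟_)
open import Data.Fin.Subset using (Subset; ∣_∣; _∩_)
open import Data.Vec using (lookup)
open import Data.List using (List; []; _∷_; length; allFin)
open import Data.Bool.ListAction using (all; any)
open import Data.List.Relation.Unary.All using (All)
open import Relation.Binary.PropositionalEquality using (_≡_)
open import Relation.Nullary.Decidable using (⌊_⌋)

ℕ→ℚ : ℕ → ℚ
ℕ→ℚ n = (+ n) / 1

stirling2 : ℕ → ℕ → ℕ
stirling2 zero    zero    = 1
stirling2 zero    (suc k) = 0
stirling2 (suc n) zero    = 0
stirling2 (suc n) (suc k) = suc k * stirling2 n (suc k) + stirling2 n k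

-- k-uniform multihypergraph on vertex set Fin n; edges form a list (multiset)
record MultiHypergraph (k n : ℕ) : Set where
  field
    edges   : List (Subset n)
    uniform : All (λ e → ∣ e ∣ ≡ k) edges
open MultiHypergraph public

numEdges : ∀ {k n} → MultiHypergraph k n → ℕ
numEdges H = length (edges H)

countᵇ : ∀ {A : Set} → (A → Bool) → List A → ℕ
countᵇ p []       = 0
countᵇ p (x ∷ xs) = if p x then suc (countᵇ p xs) else countᵇ p xs

Cut : ℕ → ℕ → Set
Cut n r = Fin n → Fin r

crossesᵇ : ∀ {n r} → Cut n r → Subset n → Bool
crossesᵇ {n} {r} χ e =
  all (λ i → any (λ v → lookup e v ∧ ⌊ χ v ≟ i ⌋) (allFin n)) (allFin r)

cutSize : ∀ {k n r} → MultiHypergraph k n → Cut n r → ℕ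
cutSize H χ = countᵇ (crossesᵇ χ) (edges H)

excess : ∀ {n} (k r : ℕ) .{{_ : NonZero r}} → MultiHypergraph k n → Cut n r → ℚ
excess k r H χ =
  ℕ→ℚ (cutSize H χ)
    - ((+ (stirling2 k r * (r !) * numEdges H)) / (r ^ k)) {{m^n≢0 r k}}

edgesMostlyIn : ∀ {k n} → MultiHypergraph k n → Subset n → ℕ
edgesMostlyIn {k} H U = countᵇ (λ e → (k ∸ 1) ≤ᵇ ∣ e ∩ U ∣) (edges H)

-- Colour V(H) uniformly at random with r colours, conditioned on the pairs of a matching of ∁ U
-- receiving different colours. Such conditioning never lowers the probability that an edge is cut, and
-- for an edge containing a matched pair it raises it by r (r-1)! S(k-1, r-1) / ((r-1) r^k). If fewer
-- than m/2 edges have k-1 vertices in U, every other edge contains two vertices of ∁ U; the pairs of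
-- ∁ U split into 2b matchings by the sum of their ranks, so one matching meets at least m/(4b) edges,
-- and a colouring at least as good as the conditioned average has excess at least c m / b.
module Submission where

module Combinatorics where

  open import Data.Nat using (ℕ; zero; suc; pred; _+_; _*_; _∸_; _^_; _!; _≤_; _<_; _≤?_; _<?_; _≤ᵇ_; s≤s; z≤n;
                              NonZero; >-nonZero; >-nonZero⁻¹)
  open import Data.Nat.Properties renaming (_≟_ to _≟ℕ_)
  open import Data.Nat.Tactic.RingSolver using (solve-∀)
  open import Algebra.Properties.CommutativeSemigroup *-commutativeSemigroup using (x∙yz≈y∙xz; xy∙z≈xz∙y; xy∙z≈y∙xz)
  open import Algebra.Properties.Semiring.Sum +-*-semiring
    using (sum; sum-syntax; sum-cong-≗; ∑-distrib-+; ∑-comm; *-distribˡ-sum)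
  open import Data.Bool using (Bool; true; false; not; T; if_then_else_; _∧_; _∨_)
  open import Data.Bool.Properties using (∨-identityʳ; ∨-assoc; ∧-conicalˡ; ∧-conicalʳ; T-≡)
  open import Data.Bool.ListAction using (all; any)
  open import Data.Fin using (Fin; zero; suc; _≟_; toℕ; fromℕ<)
  open import Data.Fin.Properties using (toℕ-fromℕ<; any?) renaming (suc-injective to suc-injectiveᶠ)
  open import Data.Fin.Subset using (Subset; ∣_∣; _∪_; _∩_; ∁; ⁅_⁆; ⊥)
  open import Data.Fin.Subset.Properties using (∣p∣≤n; ∣⊥∣≡0; ∣∁p∣≡n∸∣p∣)
  open import Data.Vec using (Vec; []; _∷_; lookup; _[_]≔_)
  open import Data.Vec.Properties using (lookup∘update; lookup∘update′; lookup-zipWith; lookup-replicate)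
  open import Data.List using (List; []; _∷_; length; foldr; tabulate; allFin; cartesianProduct)
  open import Data.List.Membership.Propositional using (_∈_; find; lose)
  open import Data.List.Membership.Propositional.Properties using (∈-allFin; ∈-cartesianProduct⁺)
  open import Data.List.Relation.Unary.All as All using (All; []; _∷_)
  open import Data.List.Relation.Unary.Any using (here; there)
  open import Data.List.Relation.Unary.Any.Properties using (any⁺; any⁻)
  open import Data.Product using (_×_; _,_; ∃; ∃₂; proj₁; proj₂)
  open import Data.Product.Properties using (≡-dec)
  open import Data.Sum using (_⊎_; inj₁; inj₂)
  open import Data.Empty using (⊥-elim)
  open import Function using (_∘_)
  open import Function.Bundles using (Equivalence)
  open import Relation.Nullary using (Dec; yes; no)
  open import Relation.Nullary.Decidable using (⌊_⌋; toWitness; fromWitness)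
  open import Relation.Binary.Definitions using (tri<; tri≈; tri>)
  open import Relation.Binary.PropositionalEquality
  open import Defs using (stirling2; crossesᵇ; countᵇ; MultiHypergraph; edges; uniform; numEdges; cutSize; edgesMostlyIn)

  ∑-const : ∀ m a → ∑[ i < m ] a ≡ m * a
  ∑-const zero    a = refl
  ∑-const (suc m) a = cong (a +_) (∑-const m a)

  ∑-mono : ∀ {m} {g h : Fin m → ℕ} → (∀ i → g i ≤ h i) → sum g ≤ sum h
  ∑-mono {zero}  le = z≤n
  ∑-mono {suc m} {g} {h} le =
    +-mono-≤ (le zero) (∑-mono {g = λ i → g (suc i)} {h = λ i → h (suc i)} (λ i → le (suc i)))

  ∑-strict : ∀ {m} {g h : Fin m → ℕ} → (∀ i → g i ≤ h i) → ∀ i → g i < h i → sum g < sum h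
  ∑-strict {suc m} {g} {h} le zero lt =
    +-mono-<-≤ lt (∑-mono {g = λ i → g (suc i)} {h = λ i → h (suc i)} (λ i → le (suc i)))
  ∑-strict {suc m} {g} {h} le (suc i) lt =
    +-mono-≤-< (le zero) (∑-strict {g = λ i → g (suc i)} {h = λ i → h (suc i)} (λ i → le (suc i)) i lt)

  ∑-positive : ∀ {m} (g : Fin m → ℕ) → 0 < sum g → ∃ λ i → 0 < g i
  ∑-positive {suc m} g pos with g zero in eq
  ... | suc _ = zero , subst (0 <_) (sym eq) (s≤s z≤n)
  ... | zero with ∑-positive (λ i → g (suc i)) pos
  ...   | i , gi>0 = suc i , gi>0

  ∑-term : ∀ {m} (g : Fin m → ℕ) i → g i ≤ sum g
  ∑-term g zero    = m≤m+n (g zero) _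
  ∑-term g (suc i) = ≤-trans (∑-term (λ j → g (suc j)) i) (m≤n+m _ (g zero))

  ∑≤*max : ∀ {m} (g : Fin m → ℕ) → Fin m → ∃ λ i → sum g ≤ m * g i
  ∑≤*max {suc zero}    g _ = zero , ≤-refl
  ∑≤*max {suc (suc m)} g _ with ∑≤*max (λ j → g (suc j)) zero
  ... | i , tail≤ with g zero ≤? g (suc i)
  ...   | yes g₀≤ = suc i , +-mono-≤ g₀≤ tail≤
  ...   | no  g₀≰ = zero , +-monoʳ-≤ (g zero) (≤-trans tail≤ (*-monoʳ-≤ (suc m) (<⇒≤ (≰⇒> g₀≰))))

  agree differ : ∀ {m} → Fin m → Fin m → ℕ
  agree  a b = if ⌊ a ≟ b ⌋ then 1 else 0
  differ a b = if ⌊ a ≟ b ⌋ then 0 else 1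

  agree+differ : ∀ {m} (a b : Fin m) → agree a b + differ a b ≡ 1
  agree+differ a b with a ≟ b
  ... | yes _ = refl
  ... | no  _ = refl

  differ-idem : ∀ {m} (a b : Fin m) → differ a b * differ a b ≡ differ a b
  differ-idem a b with a ≟ b
  ... | yes _ = refl
  ... | no  _ = refl

  differ-sym : ∀ {m} (a b : Fin m) → differ a b ≡ differ b a
  differ-sym a b with a ≟ b | b ≟ a
  ... | yes _   | yes _   = refl
  ... | no  _   | no  _   = refl
  ... | yes a≡b | no  b≢a = ⊥-elim (b≢a (sym a≡b))
  ... | no  a≢b | yes b≡a = ⊥-elim (a≢b (sym b≡a))

  agree-suc : ∀ {m} (a b : Fin m) → agree (suc a) (suc b) ≡ agree a b
  agree-suc a b with a ≟ b
  ... | yes _ = refl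
  ... | no  _ = refl

  differ-suc : ∀ {m} (a b : Fin m) → differ (suc a) (suc b) ≡ differ a b
  differ-suc a b with a ≟ b
  ... | yes _ = refl
  ... | no  _ = refl

  ∑-agree : ∀ m (a : Fin m) (h : Fin m → ℕ) → ∑[ b < m ] (agree a b * h b) ≡ h a
  ∑-agree (suc m) zero h = begin
    (h zero + 0) + ∑[ b < m ] 0  ≡⟨ cong₂ _+_ (+-identityʳ (h zero)) (∑-const m 0) ⟩
    h zero + m * 0               ≡⟨ cong (h zero +_) (*-zeroʳ m) ⟩
    h zero + 0                   ≡⟨ +-identityʳ (h zero) ⟩
    h zero                       ∎
    where open ≡-Reasoning
  ∑-agree (suc m) (suc a) h =
    trans (sum-cong-≗ (λ b → cong (_* h (suc b)) (agree-suc a b))) (∑-agree m a (λ b → h (suc b)))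

  ∑-differ : ∀ m (a : Fin (suc m)) → ∑[ b < suc m ] differ a b ≡ m
  ∑-differ m zero = trans (∑-const m 1) (*-identityʳ m)
  ∑-differ (suc m) (suc a) = cong suc (trans (sum-cong-≗ (differ-suc a)) (∑-differ m a))

  ∑-split : ∀ m (a : Fin m) (h : Fin m → ℕ) → sum h ≡ h a + ∑[ b < m ] (differ a b * h b)
  ∑-split m a h = begin
    sum h
      ≡⟨ sum-cong-≗ (λ b → sym (trans (sym (*-distribʳ-+ (h b) (agree a b) (differ a b)))
                                       (trans (cong (_* h b) (agree+differ a b)) (*-identityˡ (h b))))) ⟩
    ∑[ b < m ] (agree a b * h b + differ a b * h b)
      ≡⟨ ∑-distrib-+ (λ b → agree a b * h b) (λ b → differ a b * h b) ⟩
    ∑[ b < m ] (agree a b * h b) + ∑[ b < m ] (differ a b * h b)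
      ≡⟨ cong (_+ ∑[ b < m ] (differ a b * h b)) (∑-agree m a h) ⟩
    h a + ∑[ b < m ] (differ a b * h b) ∎
    where open ≡-Reasoning

  ∑-without-minimum : ∀ r1 (a : Fin (suc r1)) (h : Fin (suc r1) → ℕ) → (∀ b → h a ≤ h b) →
    r1 * sum h ≤ suc r1 * ∑[ b < suc r1 ] (differ a b * h b)
  ∑-without-minimum r1 a h min = begin
    r1 * sum h            ≡⟨ cong (r1 *_) (∑-split (suc r1) a h) ⟩
    r1 * (h a + X)        ≡⟨ *-distribˡ-+ r1 (h a) X ⟩
    r1 * h a + r1 * X     ≤⟨ +-monoˡ-≤ (r1 * X) r1·ha≤X ⟩
    X + r1 * X            ∎
    where
    open ≤-Reasoning
    X = ∑[ b < suc r1 ] (differ a b * h b)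
    r1·ha≤X : r1 * h a ≤ X
    r1·ha≤X = begin
      r1 * h a                                 ≡⟨ cong (_* h a) (sym (∑-differ r1 a)) ⟩
      sum (differ a) * h a                     ≡⟨ *-comm (sum (differ a)) (h a) ⟩
      h a * sum (differ a)                     ≡⟨ *-distribˡ-sum (h a) (differ a) ⟩
      ∑[ b < suc r1 ] (h a * differ a b)       ≤⟨ ∑-mono (λ b → ≤-trans (≤-reflexive (*-comm (h a) (differ a b)))
                                                                        (*-monoʳ-≤ (differ a b) (min b))) ⟩
      X                                        ∎

  -- Sums over all colourings

  Colouring : ℕ → ℕ → Set
  Colouring r n = Vec (Fin r) n

  sumᵛ : ∀ r n → (Colouring r n → ℕ) → ℕ
  sumᵛ r zero    f = f []
  sumᵛ r (suc n) f = ∑[ c < r ] sumᵛ r n (λ v → f (c ∷ v))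

  sumᵛ-cong : ∀ r n {f g : Colouring r n → ℕ} → (∀ v → f v ≡ g v) → sumᵛ r n f ≡ sumᵛ r n g
  sumᵛ-cong r zero    eq = eq []
  sumᵛ-cong r (suc n) eq = sum-cong-≗ (λ c → sumᵛ-cong r n (λ v → eq (c ∷ v)))

  sumᵛ-+ : ∀ r n (f g : Colouring r n → ℕ) → sumᵛ r n (λ v → f v + g v) ≡ sumᵛ r n f + sumᵛ r n g
  sumᵛ-+ r zero    f g = refl
  sumᵛ-+ r (suc n) f g = trans (sum-cong-≗ (λ c → sumᵛ-+ r n (λ v → f (c ∷ v)) (λ v → g (c ∷ v))))
    (∑-distrib-+ (λ c → sumᵛ r n (λ v → f (c ∷ v))) (λ c → sumᵛ r n (λ v → g (c ∷ v))))

  sumᵛ-*ˡ : ∀ r n a (f : Colouring r n → ℕ) → sumᵛ r n (λ v → a * f v) ≡ a * sumᵛ r n f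
  sumᵛ-*ˡ r zero    a f = refl
  sumᵛ-*ˡ r (suc n) a f = trans (sum-cong-≗ (λ c → sumᵛ-*ˡ r n a (λ v → f (c ∷ v))))
    (sym (*-distribˡ-sum a (λ c → sumᵛ r n (λ v → f (c ∷ v)))))

  sumᵛ-const : ∀ r n a → sumᵛ r n (λ _ → a) ≡ r ^ n * a
  sumᵛ-const r zero    a = sym (+-identityʳ a)
  sumᵛ-const r (suc n) a = begin
    ∑[ c < r ] sumᵛ r n (λ _ → a) ≡⟨ sum-cong-≗ {r} (λ c → sumᵛ-const r n a) ⟩
    ∑[ c < r ] (r ^ n * a)        ≡⟨ ∑-const r _ ⟩
    r * (r ^ n * a)               ≡⟨ *-assoc r (r ^ n) a ⟨
    r * r ^ n * a                 ∎
    where open ≡-Reasoning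

  sumᵛ-mono : ∀ r n {f g : Colouring r n → ℕ} → (∀ v → f v ≤ g v) → sumᵛ r n f ≤ sumᵛ r n g
  sumᵛ-mono r zero    le = le []
  sumᵛ-mono r (suc n) le = ∑-mono (λ c → sumᵛ-mono r n (λ v → le (c ∷ v)))

  sumᵛ-strict : ∀ r n {f g : Colouring r n → ℕ} → (∀ v → f v ≤ g v) → ∀ v → f v < g v → sumᵛ r n f < sumᵛ r n g
  sumᵛ-strict r zero    le [] lt = lt
  sumᵛ-strict r (suc n) le (c ∷ v) lt =
    ∑-strict (λ c′ → sumᵛ-mono r n (λ v′ → le (c′ ∷ v′))) c (sumᵛ-strict r n (λ v′ → le (c ∷ v′)) v lt)

  sumᵛ-∑ : ∀ r n m (g : Colouring r n → Fin m → ℕ) →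
    sumᵛ r n (λ v → ∑[ b < m ] g v b) ≡ ∑[ b < m ] sumᵛ r n (λ v → g v b)
  sumᵛ-∑ r zero    m g = refl
  sumᵛ-∑ r (suc n) m g = trans (sum-cong-≗ (λ c → sumᵛ-∑ r n m (λ v → g (c ∷ v))))
    (∑-comm (λ c b → sumᵛ r n (λ v → g (c ∷ v) b)))

  sumᵛ-recolour : ∀ r n (y : Fin n) (f : Colouring r n → ℕ) →
    sumᵛ r n (λ v → ∑[ b < r ] f (v [ y ]≔ b)) ≡ r * sumᵛ r n f
  sumᵛ-recolour r (suc n) zero f = begin
    ∑[ c < r ] sumᵛ r n (λ v → ∑[ b < r ] f (b ∷ v)) ≡⟨ ∑-const r _ ⟩
    r * sumᵛ r n (λ v → ∑[ b < r ] f (b ∷ v))        ≡⟨ cong (r *_) (sumᵛ-∑ r n r _) ⟩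
    r * ∑[ b < r ] sumᵛ r n (λ v → f (b ∷ v))        ∎
    where open ≡-Reasoning
  sumᵛ-recolour r (suc n) (suc y) f = begin
    ∑[ c < r ] sumᵛ r n (λ v → ∑[ b < r ] f (c ∷ (v [ y ]≔ b)))
      ≡⟨ sum-cong-≗ (λ c → sumᵛ-recolour r n y (λ v → f (c ∷ v))) ⟩
    ∑[ c < r ] (r * sumᵛ r n (λ v → f (c ∷ v)))
      ≡⟨ *-distribˡ-sum r (λ c → sumᵛ r n (λ v → f (c ∷ v))) ⟨
    r * sumᵛ r (suc n) f ∎
    where open ≡-Reasoning

  sumᵛ-positive : ∀ r n (f : Colouring r n → ℕ) → 0 < sumᵛ r n f → ∃ λ v → 0 < f v
  sumᵛ-positive r zero    f pos = [] , pos
  sumᵛ-positive r (suc n) f pos with ∑-positive _ pos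
  ... | c , pos′ with sumᵛ-positive r n (λ v → f (c ∷ v)) pos′
  ...   | v , fv>0 = c ∷ v , fv>0

  ∃-colouring? : ∀ r n (P : Colouring r n → Set) → (∀ v → Dec (P v)) → Dec (∃ P)
  ∃-colouring? r zero P P? with P? []
  ... | yes p  = yes ([] , p)
  ... | no ¬p = no (λ { ([] , p) → ¬p p })
  ∃-colouring? r (suc n) P P? with any? (λ c → ∃-colouring? r n (λ v → P (c ∷ v)) (λ v → P? (c ∷ v)))
  ... | yes (c , v , p) = yes (c ∷ v , p)
  ... | no ¬p           = no (λ { (c ∷ v , p) → ¬p (c , v , p) })

  weighted-average-attained : ∀ r n (w g : Colouring r n → ℕ) c → 0 < sumᵛ r n w →
    sumᵛ r n w * c ≤ sumᵛ r n (λ v → w v * g v) → ∃ λ v → c ≤ g v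
  weighted-average-attained r n w g c pos avg with ∃-colouring? r n (λ v → c ≤ g v) (λ v → c ≤? g v)
  ... | yes found = found
  ... | no none = ⊥-elim (<⇒≱ below avg)
    where
    g<c : ∀ v → g v < c
    g<c v = ≰⇒> (λ c≤gv → none (v , c≤gv))
    v₀ = proj₁ (sumᵛ-positive r n w pos)
    instance
      w₀≢0 : NonZero (w v₀)
      w₀≢0 = >-nonZero (proj₂ (sumᵛ-positive r n w pos))
    below : sumᵛ r n (λ v → w v * g v) < sumᵛ r n w * c
    below = subst (sumᵛ r n (λ v → w v * g v) <_)
      (trans (sumᵛ-cong r n (λ v → *-comm (w v) c)) (trans (sumᵛ-*ˡ r n c w) (*-comm c _)))
      (sumᵛ-strict r n (λ v → *-monoʳ-≤ (w v) (<⇒≤ (g<c v))) v₀ (*-monoʳ-< (w v₀) (g<c v₀)))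

  -- Covering numbers and Stirling numbers

  -- covering r j u counts the maps from a j-set to Fin r whose image contains u prescribed colours;
  -- covering r j r counts the surjections.
  covering : ℕ → ℕ → ℕ → ℕ
  covering r zero    zero    = 1
  covering r zero    (suc u) = 0
  covering r (suc j) u       = (r ∸ u) * covering r j u + u * covering r j (u ∸ 1)

  covering-split : ∀ r′ j u → u ≤ r′ → covering (suc r′) j u ≡ covering (suc r′) j (suc u) + covering r′ j u
  covering-split r′ zero zero    _ = refl
  covering-split r′ zero (suc u) _ = refl
  covering-split r′ (suc j) u u≤r′ = begin
    (suc r′ ∸ u) * A + u * covering (suc r′) j (u ∸ 1)
      ≡⟨ cong₂ (λ x y → x * A + y) (+-∸-assoc 1 u≤r′) (split-pred u u≤r′) ⟩
    suc d * A + u * (A + P′)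
      ≡⟨ cong (λ z → suc d * z + u * (z + P′)) A≡ ⟩
    suc d * (A⁺ + A′) + u * ((A⁺ + A′) + P′)
      ≡⟨ regroup d u A⁺ A′ P′ ⟩
    (d * A⁺ + suc u * (A⁺ + A′)) + (d * A′ + u * P′)
      ≡⟨ cong (λ z → (d * A⁺ + suc u * z) + (d * A′ + u * P′)) A≡ ⟨
    (d * A⁺ + suc u * A) + (d * A′ + u * P′) ∎
    where
    open ≡-Reasoning
    d  = r′ ∸ u
    A  = covering (suc r′) j u
    A⁺ = covering (suc r′) j (suc u)
    A′ = covering r′ j u
    P′ = covering r′ j (u ∸ 1)
    A≡ : A ≡ A⁺ + A′
    A≡ = covering-split r′ j u u≤r′
    regroup : ∀ d u a b p → suc d * (a + b) + u * ((a + b) + p) ≡ (d * a + suc u * (a + b)) + (d * b + u * p)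
    regroup = solve-∀
    split-pred : ∀ u → u ≤ r′ → u * covering (suc r′) j (u ∸ 1) ≡ u * (covering (suc r′) j u + covering r′ j (u ∸ 1))
    split-pred zero     _   = refl
    split-pred (suc u′) u≤r′ = cong (suc u′ *_) (covering-split r′ j u′ (≤-trans (n≤1+n u′) u≤r′))

  surjections-suc : ∀ r′ j → covering (suc r′) (suc j) (suc r′) ≡ suc r′ * (covering (suc r′) j (suc r′) + covering r′ j r′)
  surjections-suc r′ j =
    cong₂ (λ x y → x * covering (suc r′) j (suc r′) + suc r′ * y) (n∸n≡0 r′) (covering-split r′ j r′ ≤-refl)

  surjections≡!*stirling2 : ∀ j r → covering r j r ≡ r ! * stirling2 j r
  surjections≡!*stirling2 zero    zero     = refl
  surjections≡!*stirling2 zero    (suc r)  = sym (*-zeroʳ (suc r !))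
  surjections≡!*stirling2 (suc j) zero     = refl
  surjections≡!*stirling2 (suc j) (suc r′) = begin
    covering (suc r′) (suc j) (suc r′)
      ≡⟨ surjections-suc r′ j ⟩
    suc r′ * (covering (suc r′) j (suc r′) + covering r′ j r′)
      ≡⟨ cong₂ (λ x y → suc r′ * (x + y)) (surjections≡!*stirling2 j (suc r′)) (surjections≡!*stirling2 j r′) ⟩
    suc r′ * (suc r′ ! * stirling2 j (suc r′) + r′ ! * stirling2 j r′)
      ≡⟨ regroup r′ (r′ !) _ _ ⟩
    suc r′ ! * stirling2 (suc j) (suc r′) ∎
    where
    open ≡-Reasoning
    regroup : ∀ r f s₁ s₀ → suc r * (suc r * f * s₁ + f * s₀) ≡ suc r * f * (suc r * s₁ + s₀)
    regroup = solve-∀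

  stirling2-diagonal : ∀ j → 1 ≤ stirling2 j j
  stirling2-diagonal zero    = s≤s z≤n
  stirling2-diagonal (suc j) = ≤-trans (stirling2-diagonal j) (m≤n+m _ _)

  stirling2-positive : ∀ j r → r ≤ j → 1 ≤ stirling2 (suc j) (suc r)
  stirling2-positive zero    zero _ = s≤s z≤n
  stirling2-positive (suc j) r r≤j with m≤n⇒m<n∨m≡n r≤j
  ... | inj₂ refl       = ≤-trans (stirling2-diagonal (suc j)) (m≤n+m _ (suc (suc j) * stirling2 (suc j) (suc (suc j))))
  ... | inj₁ (s≤s r≤j′) =
    ≤-trans (stirling2-positive j r r≤j′) (≤-trans (m≤n*m _ (suc r)) (m≤m+n _ _))

  surjections-positive : ∀ r j → r ≤ j → 1 ≤ covering (suc r) (suc j) (suc r)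
  surjections-positive r j r≤j = subst (1 ≤_) (sym (surjections≡!*stirling2 (suc j) (suc r)))
    (*-mono-≤ (1≤n! (suc r)) (stirling2-positive j r r≤j))

  boolToℕ : Bool → ℕ
  boolToℕ true  = 1
  boolToℕ false = 0

  boolToℕ-mono : ∀ {a b} → (a ≡ true → b ≡ true) → boolToℕ a ≤ boolToℕ b
  boolToℕ-mono {false} _ = z≤n
  boolToℕ-mono {true}  f rewrite f refl = ≤-refl

  allᶠ anyᶠ : ∀ {m} → (Fin m → Bool) → Bool
  allᶠ {zero}  p = true
  allᶠ {suc m} p = p zero ∧ allᶠ (λ i → p (suc i))
  anyᶠ {zero}  p = false
  anyᶠ {suc m} p = p zero ∨ anyᶠ (λ i → p (suc i))

  allᶠ-cong : ∀ {m} {p q : Fin m → Bool} → (∀ i → p i ≡ q i) → allᶠ p ≡ allᶠ q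
  allᶠ-cong {zero}  eq = refl
  allᶠ-cong {suc m} eq = cong₂ _∧_ (eq zero) (allᶠ-cong (λ i → eq (suc i)))

  anyᶠ-cong : ∀ {m} {p q : Fin m → Bool} → (∀ i → p i ≡ q i) → anyᶠ p ≡ anyᶠ q
  anyᶠ-cong {zero}  eq = refl
  anyᶠ-cong {suc m} eq = cong₂ _∨_ (eq zero) (anyᶠ-cong (λ i → eq (suc i)))

  all-tabulate : ∀ {A : Set} m (p : A → Bool) (f : Fin m → A) → all p (tabulate f) ≡ allᶠ (λ i → p (f i))
  all-tabulate zero    p f = refl
  all-tabulate (suc m) p f = cong (p (f zero) ∧_) (all-tabulate m p (λ i → f (suc i)))

  any-tabulate : ∀ {A : Set} m (p : A → Bool) (f : Fin m → A) → any p (tabulate f) ≡ anyᶠ (λ i → p (f i))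
  any-tabulate zero    p f = refl
  any-tabulate (suc m) p f = cong (p (f zero) ∨_) (any-tabulate m p (λ i → f (suc i)))

  allᶠ-elim : ∀ {m} {p : Fin m → Bool} → allᶠ p ≡ true → ∀ i → p i ≡ true
  allᶠ-elim {suc m} {p} h zero    = ∧-conicalˡ (p zero) _ h
  allᶠ-elim {suc m} {p} h (suc i) = allᶠ-elim (∧-conicalʳ (p zero) _ h) i

  allᶠ-intro : ∀ {m} {p : Fin m → Bool} → (∀ i → p i ≡ true) → allᶠ p ≡ true
  allᶠ-intro {zero}      h = refl
  allᶠ-intro {suc m} {p} h rewrite h zero = allᶠ-intro (λ i → h (suc i))

  anyᶠ-elim : ∀ {m} {p : Fin m → Bool} → anyᶠ p ≡ true → ∃ λ i → p i ≡ true
  anyᶠ-elim {suc m} {p} h with p zero in eq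
  ... | true  = zero , eq
  ... | false with anyᶠ-elim {p = λ i → p (suc i)} h
  ...   | i , pi = suc i , pi

  anyᶠ-intro : ∀ {m} {p : Fin m → Bool} i → p i ≡ true → anyᶠ p ≡ true
  anyᶠ-intro {suc m} {p} zero h rewrite h = refl
  anyᶠ-intro {suc m} {p} (suc i) h with p zero
  ... | true  = refl
  ... | false = anyᶠ-intro i h

  any≡true⇒∃ : ∀ {A : Set} (p : A → Bool) xs → any p xs ≡ true → ∃ λ x → x ∈ xs × p x ≡ true
  any≡true⇒∃ p xs h with find (any⁻ p xs (Equivalence.from T-≡ h))
  ... | x , x∈xs , px = x , x∈xs , Equivalence.to T-≡ px

  ∈⇒any≡true : ∀ {A : Set} (p : A → Bool) {xs x} → x ∈ xs → p x ≡ true → any p xs ≡ true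
  ∈⇒any≡true p x∈xs px = Equivalence.to T-≡ (any⁺ p (lose x∈xs (Equivalence.from T-≡ px)))

  ⌊⌋≡true⇒ : ∀ {P : Set} (d : Dec P) → ⌊ d ⌋ ≡ true → P
  ⌊⌋≡true⇒ d h = toWitness {a? = d} (Equivalence.from T-≡ h)

  ⇒⌊⌋≡true : ∀ {P : Set} (d : Dec P) → P → ⌊ d ⌋ ≡ true
  ⇒⌊⌋≡true d p = Equivalence.to T-≡ (fromWitness {a? = d} p)

  crosses : ∀ {r n} → Colouring r n → Subset n → Bool
  crosses v e = allᶠ (λ i → anyᶠ (λ u → lookup e u ∧ ⌊ lookup v u ≟ i ⌋))

  crossing : ∀ {r n} → Colouring r n → Subset n → ℕ
  crossing v e = boolToℕ (crosses v e)

  crossesᵇ≡crosses : ∀ {r n} (v : Colouring r n) (e : Subset n) → crossesᵇ (lookup v) e ≡ crosses v e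
  crossesᵇ≡crosses {r} {n} v e = trans (all-tabulate r _ (λ i → i))
    (allᶠ-cong (λ i → any-tabulate n (λ u → lookup e u ∧ ⌊ lookup v u ≟ i ⌋) (λ u → u)))

  Meets-all-colours : ∀ {r n} → Colouring r n → Subset n → Set
  Meets-all-colours v e = ∀ i → ∃ λ u → lookup e u ≡ true × lookup v u ≡ i

  crosses⇒meets : ∀ {r n} (v : Colouring r n) (e : Subset n) → crosses v e ≡ true → Meets-all-colours v e
  crosses⇒meets v e h i with anyᶠ-elim (allᶠ-elim h i)
  ... | u , q = u , ∧-conicalˡ (lookup e u) _ q , ⌊⌋≡true⇒ (lookup v u ≟ i) (∧-conicalʳ (lookup e u) _ q)

  meets⇒crosses : ∀ {r n} (v : Colouring r n) (e : Subset n) → Meets-all-colours v e → crosses v e ≡ true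
  meets⇒crosses v e h = allᶠ-intro λ i → let (u , eu , vu≡i) = h i in
    anyᶠ-intro u (subst (λ b → b ∧ ⌊ lookup v u ≟ i ⌋ ≡ true) (sym eu) (⇒⌊⌋≡true (lookup v u ≟ i) vu≡i))

  full : ∀ {r} → Subset r → Bool
  full []      = true
  full (b ∷ T) = b ∧ full T

  coversWith : ∀ {r n} → Subset r → Colouring r n → Subset n → Bool
  coversWith T []      []      = full T
  coversWith T (c ∷ v) (b ∷ e) = coversWith (if b then T ∪ ⁅ c ⁆ else T) v e

  full≡allᶠ : ∀ {r} (T : Subset r) → full T ≡ allᶠ (λ i → lookup T i ∨ false)
  full≡allᶠ []      = refl
  full≡allᶠ (b ∷ T) = cong₂ _∧_ (sym (∨-identityʳ b)) (full≡allᶠ T)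

  lookup-⁅⁆ : ∀ {m} (c i : Fin m) → lookup ⁅ c ⁆ i ≡ ⌊ c ≟ i ⌋
  lookup-⁅⁆ zero    zero    = refl
  lookup-⁅⁆ zero    (suc i) = lookup-replicate i false
  lookup-⁅⁆ (suc c) zero    = refl
  lookup-⁅⁆ (suc c) (suc i) with c ≟ i | lookup-⁅⁆ c i
  ... | yes _ | eq = eq
  ... | no  _ | eq = eq

  coversWith≡allᶠ : ∀ {r n} (T : Subset r) (v : Colouring r n) (e : Subset n) →
    coversWith T v e ≡ allᶠ (λ i → lookup T i ∨ anyᶠ (λ u → lookup e u ∧ ⌊ lookup v u ≟ i ⌋))
  coversWith≡allᶠ T []      []          = full≡allᶠ T
  coversWith≡allᶠ T (c ∷ v) (false ∷ e) = coversWith≡allᶠ T v e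
  coversWith≡allᶠ T (c ∷ v) (true ∷ e)  = trans (coversWith≡allᶠ (T ∪ ⁅ c ⁆) v e) (allᶠ-cong λ i →
    trans (cong (_∨ _) (trans (lookup-zipWith _∨_ i T ⁅ c ⁆) (cong (lookup T i ∨_) (lookup-⁅⁆ c i))))
          (∨-assoc (lookup T i) _ _))

  crosses≡coversWith⊥ : ∀ {r n} (v : Colouring r n) (e : Subset n) → crosses v e ≡ coversWith ⊥ v e
  crosses≡coversWith⊥ {r} v e = sym (trans (coversWith≡allᶠ ⊥ v e)
    (allᶠ-cong (λ i → cong (_∨ anyᶠ (λ u → lookup e u ∧ ⌊ lookup v u ≟ i ⌋)) (lookup-replicate {n = r} i false))))

  full-covering : ∀ r₀ {r} (T : Subset r) → boolToℕ (full T) ≡ covering r₀ 0 (r ∸ ∣ T ∣)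
  full-covering r₀ []                = refl
  full-covering r₀ (true ∷ T)        = full-covering r₀ T
  full-covering r₀ {suc r} (false ∷ T) = sym (cong (covering r₀ 0) (+-∸-assoc 1 (∣p∣≤n T)))

  ∪-⊥ : ∀ {m} (T : Subset m) → T ∪ ⊥ ≡ T
  ∪-⊥ []      = refl
  ∪-⊥ (b ∷ T) = cong₂ _∷_ (∨-identityʳ b) (∪-⊥ T)

  ∑-∣∪⁅⁆∣ : ∀ {r} (T : Subset r) (g : ℕ → ℕ) →
    ∑[ c < r ] g ∣ T ∪ ⁅ c ⁆ ∣ ≡ ∣ T ∣ * g ∣ T ∣ + (r ∸ ∣ T ∣) * g (suc ∣ T ∣)
  ∑-∣∪⁅⁆∣ [] g = refl
  ∑-∣∪⁅⁆∣ {suc r} (true ∷ T) g = begin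
    g (suc ∣ T ∪ ⊥ ∣) + ∑[ c < r ] g (suc ∣ T ∪ ⁅ c ⁆ ∣)
      ≡⟨ cong₂ _+_ (cong (λ z → g (suc ∣ z ∣)) (∪-⊥ T)) (∑-∣∪⁅⁆∣ T (λ s → g (suc s))) ⟩
    g (suc ∣ T ∣) + (∣ T ∣ * g (suc ∣ T ∣) + (r ∸ ∣ T ∣) * g (suc (suc ∣ T ∣)))
      ≡⟨ +-assoc (g (suc ∣ T ∣)) _ _ ⟨
    suc ∣ T ∣ * g (suc ∣ T ∣) + (r ∸ ∣ T ∣) * g (suc (suc ∣ T ∣)) ∎
    where open ≡-Reasoning
  ∑-∣∪⁅⁆∣ {suc r} (false ∷ T) g = begin
    g (suc ∣ T ∪ ⊥ ∣) + ∑[ c < r ] g ∣ T ∪ ⁅ c ⁆ ∣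
      ≡⟨ cong₂ _+_ (cong (λ z → g (suc ∣ z ∣)) (∪-⊥ T)) (∑-∣∪⁅⁆∣ T g) ⟩
    g (suc ∣ T ∣) + (∣ T ∣ * g ∣ T ∣ + (r ∸ ∣ T ∣) * g (suc ∣ T ∣))
      ≡⟨ regroup ∣ T ∣ (g ∣ T ∣) (g (suc ∣ T ∣)) (r ∸ ∣ T ∣) ⟩
    ∣ T ∣ * g ∣ T ∣ + suc (r ∸ ∣ T ∣) * g (suc ∣ T ∣)
      ≡⟨ cong (λ z → ∣ T ∣ * g ∣ T ∣ + z * g (suc ∣ T ∣)) (+-∸-assoc 1 (∣p∣≤n T)) ⟨
    ∣ T ∣ * g ∣ T ∣ + (suc r ∸ ∣ T ∣) * g (suc ∣ T ∣) ∎
    where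
    open ≡-Reasoning
    regroup : ∀ t a b d → b + (t * a + d * b) ≡ t * a + (b + d * b)
    regroup = solve-∀

  sumᵛ-coversWith : ∀ r n (e : Subset n) (T : Subset r) →
    r ^ ∣ e ∣ * sumᵛ r n (λ v → boolToℕ (coversWith T v e)) ≡ r ^ n * covering r ∣ e ∣ (r ∸ ∣ T ∣)
  sumᵛ-coversWith r zero [] T = cong (1 *_) (full-covering r T)
  sumᵛ-coversWith r (suc n) (false ∷ e) T = begin
    r ^ ∣ e ∣ * ∑[ c < r ] C
      ≡⟨ cong (r ^ ∣ e ∣ *_) (∑-const r C) ⟩
    r ^ ∣ e ∣ * (r * C)
      ≡⟨ x∙yz≈y∙xz (r ^ ∣ e ∣) r C ⟩
    r * (r ^ ∣ e ∣ * C)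
      ≡⟨ cong (r *_) (sumᵛ-coversWith r n e T) ⟩
    r * (r ^ n * covering r ∣ e ∣ (r ∸ ∣ T ∣))
      ≡⟨ *-assoc r _ _ ⟨
    r ^ suc n * covering r ∣ e ∣ (r ∸ ∣ T ∣) ∎
    where
    open ≡-Reasoning
    C = sumᵛ r n (λ v → boolToℕ (coversWith T v e))
  sumᵛ-coversWith r (suc n) (true ∷ e) T = begin
    r * r ^ j * ∑[ c < r ] C c
      ≡⟨ *-assoc r (r ^ j) _ ⟩
    r * (r ^ j * ∑[ c < r ] C c)
      ≡⟨ cong (r *_) (*-distribˡ-sum (r ^ j) C) ⟩
    r * ∑[ c < r ] (r ^ j * C c)
      ≡⟨ cong (r *_) (sum-cong-≗ (λ c → sumᵛ-coversWith r n e (T ∪ ⁅ c ⁆))) ⟩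
    r * ∑[ c < r ] (r ^ n * covering r j (r ∸ ∣ T ∪ ⁅ c ⁆ ∣))
      ≡⟨ cong (r *_) (*-distribˡ-sum (r ^ n) (λ c → covering r j (r ∸ ∣ T ∪ ⁅ c ⁆ ∣))) ⟨
    r * (r ^ n * ∑[ c < r ] covering r j (r ∸ ∣ T ∪ ⁅ c ⁆ ∣))
      ≡⟨ cong (λ z → r * (r ^ n * z)) (∑-∣∪⁅⁆∣ T (λ s → covering r j (r ∸ s))) ⟩
    r * (r ^ n * (t * covering r j (r ∸ t) + (r ∸ t) * covering r j (r ∸ suc t)))
      ≡⟨ cong₂ (λ x y → r * (r ^ n * (x * covering r j (r ∸ t) + (r ∸ t) * covering r j y)))
               (sym (m∸[m∸n]≡n (∣p∣≤n T))) (trans (cong (r ∸_) (+-comm 1 t)) (sym (∸-+-assoc r t 1))) ⟩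
    r * (r ^ n * covering r (suc j) (r ∸ t))
      ≡⟨ *-assoc r _ _ ⟨
    r ^ suc n * covering r (suc j) (r ∸ t) ∎
    where
    open ≡-Reasoning
    j = ∣ e ∣
    t = ∣ T ∣
    C : Fin r → ℕ
    C c = sumᵛ r n (λ v → boolToℕ (coversWith (T ∪ ⁅ c ⁆) v e))

  sumᵛ-crosses : ∀ r n (e : Subset n) → r ^ ∣ e ∣ * sumᵛ r n (λ v → crossing v e) ≡ r ^ n * covering r ∣ e ∣ r
  sumᵛ-crosses r n e = begin
    r ^ ∣ e ∣ * sumᵛ r n (λ v → crossing v e)
      ≡⟨ cong (r ^ ∣ e ∣ *_) (sumᵛ-cong r n (λ v → cong boolToℕ (crosses≡coversWith⊥ v e))) ⟩
    r ^ ∣ e ∣ * sumᵛ r n (λ v → boolToℕ (coversWith ⊥ v e))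
      ≡⟨ sumᵛ-coversWith r n e ⊥ ⟩
    r ^ n * covering r (∣ e ∣) (r ∸ ∣ (⊥ {r}) ∣)
      ≡⟨ cong (λ z → r ^ n * covering r ∣ e ∣ (r ∸ z)) (∣⊥∣≡0 r) ⟩
    r ^ n * covering r ∣ e ∣ r ∎
    where open ≡-Reasoning

  crosses-recolour-outside : ∀ {r n} (v : Colouring r n) (e : Subset n) (y : Fin n) b → lookup e y ≡ false →
    crosses (v [ y ]≔ b) e ≡ crosses v e
  crosses-recolour-outside v e y b ey = allᶠ-cong (λ i → anyᶠ-cong (λ u → same-term i u))
    where
    same-term : ∀ i u → lookup e u ∧ ⌊ lookup (v [ y ]≔ b) u ≟ i ⌋ ≡ lookup e u ∧ ⌊ lookup v u ≟ i ⌋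
    same-term i u with u ≟ y
    ... | yes refl rewrite ey = refl
    ... | no  u≢y  rewrite lookup∘update′ u≢y v b = refl

  crosses-recolour-duplicate : ∀ {r n} (v : Colouring r n) (e : Subset n) {x y : Fin n} b →
    lookup e x ≡ true → x ≢ y → crosses (v [ y ]≔ lookup v x) e ≡ true → crosses (v [ y ]≔ b) e ≡ true
  crosses-recolour-duplicate v e {x} {y} b ex x≢y h = meets⇒crosses (v [ y ]≔ b) e meets
    where
    meets : Meets-all-colours (v [ y ]≔ b) e
    meets i with crosses⇒meets (v [ y ]≔ lookup v x) e h i
    ... | u , eu , vu≡i with u ≟ y
    ...   | yes refl = x , ex , trans (lookup∘update′ x≢y v b) (trans (sym (lookup∘update u v (lookup v x))) vu≡i)
    ...   | no  u≢y  = u , eu , trans (lookup∘update′ u≢y v b) (trans (sym (lookup∘update′ u≢y v (lookup v x))) vu≡i)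

  true-ext : ∀ {a b : Bool} → (a ≡ true → b ≡ true) → (b ≡ true → a ≡ true) → a ≡ b
  true-ext {true}  {true}  _ _ = refl
  true-ext {true}  {false} f _ = sym (f refl)
  true-ext {false} {true}  _ g = g refl
  true-ext {false} {false} _ _ = refl

  crosses-drop-duplicate : ∀ {r n} (w : Colouring r n) (e : Subset n) {x y : Fin n} →
    lookup e x ≡ true → x ≢ y → lookup w y ≡ lookup w x → crosses w e ≡ crosses w (e [ y ]≔ false)
  crosses-drop-duplicate w e {x} {y} ex x≢y wy≡wx = true-ext
    (λ h → meets⇒crosses w (e [ y ]≔ false) (drop (crosses⇒meets w e h)))
    (λ h → meets⇒crosses w e (keep (crosses⇒meets w (e [ y ]≔ false) h)))
    where
    drop : Meets-all-colours w e → Meets-all-colours w (e [ y ]≔ false)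
    drop m i with m i
    ... | u , eu , wu≡i with u ≟ y
    ...   | yes refl = x , trans (lookup∘update′ x≢y e false) ex , trans (sym wy≡wx) wu≡i
    ...   | no  u≢y  = u , trans (lookup∘update′ u≢y e false) eu , wu≡i
    keep : Meets-all-colours w (e [ y ]≔ false) → Meets-all-colours w e
    keep m i with m i
    ... | u , eu , wu≡i with u ≟ y
    ...   | yes refl with trans (sym (lookup∘update u e false)) eu
    ...     | ()
    keep m i | u , eu , wu≡i | no u≢y = u , trans (sym (lookup∘update′ u≢y e false)) eu , wu≡i

  ∣[]≔false∣ : ∀ {n} (e : Subset n) (y : Fin n) → lookup e y ≡ true → suc ∣ e [ y ]≔ false ∣ ≡ ∣ e ∣
  ∣[]≔false∣ (true ∷ e) zero    _  = refl
  ∣[]≔false∣ (b ∷ e)    (suc y) ey with b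
  ... | true  = cong suc (∣[]≔false∣ e y ey)
  ... | false = ∣[]≔false∣ e y ey

  -- Conditioning a uniform colouring on disjoint pairs receiving different colours

  differs : ∀ {r n} → Colouring r n → Fin n → Fin n → ℕ
  differs v x y = differ (lookup v x) (lookup v y)

  Ignores : ∀ {r n} → (Colouring r n → ℕ) → Fin n → Set
  Ignores W y = ∀ v b → W (v [ y ]≔ b) ≡ W v

  sumᵛ-differs : ∀ r1 n {x y : Fin n} (W F : Colouring (suc r1) n → ℕ) → x ≢ y → Ignores W y → Ignores F y →
    suc r1 * sumᵛ (suc r1) n (λ v → W v * differs v x y * F v) ≡ r1 * sumᵛ (suc r1) n (λ v → W v * F v)
  sumᵛ-differs r1 n {x} {y} W F x≢y W-y F-y = begin
    r * sumᵛ r n G                               ≡⟨ sumᵛ-recolour r n y G ⟨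
    sumᵛ r n (λ v → ∑[ b < r ] G (v [ y ]≔ b))   ≡⟨ sumᵛ-cong r n recoloured ⟩
    sumᵛ r n (λ v → r1 * (W v * F v))            ≡⟨ sumᵛ-*ˡ r n r1 (λ v → W v * F v) ⟩
    r1 * sumᵛ r n (λ v → W v * F v)              ∎
    where
    open ≡-Reasoning
    r = suc r1
    G : Colouring r n → ℕ
    G v = W v * differs v x y * F v
    recoloured : ∀ v → ∑[ b < r ] G (v [ y ]≔ b) ≡ r1 * (W v * F v)
    recoloured v = begin
      ∑[ b < r ] G (v [ y ]≔ b)                   ≡⟨ sum-cong-≗ G-update ⟩
      ∑[ b < r ] (W v * F v * differ (lookup v x) b) ≡⟨ *-distribˡ-sum (W v * F v) (differ (lookup v x)) ⟨
      W v * F v * sum (differ (lookup v x))       ≡⟨ cong (W v * F v *_) (∑-differ r1 (lookup v x)) ⟩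
      W v * F v * r1                              ≡⟨ *-comm _ r1 ⟩
      r1 * (W v * F v)                            ∎
      where
      G-update : ∀ b → G (v [ y ]≔ b) ≡ W v * F v * differ (lookup v x) b
      G-update b rewrite W-y v b | F-y v b | lookup∘update′ x≢y v b | lookup∘update y v b = regroup (W v) _ (F v)
        where
        regroup : ∀ w d f → w * d * f ≡ w * f * d
        regroup = solve-∀

  sumᵛ-differs-≥ : ∀ r1 n {x y : Fin n} (W F : Colouring (suc r1) n → ℕ) → x ≢ y → Ignores W y →
    (∀ v b → F (v [ y ]≔ lookup v x) ≤ F (v [ y ]≔ b)) →
    r1 * sumᵛ (suc r1) n (λ v → W v * F v) ≤ suc r1 * sumᵛ (suc r1) n (λ v → W v * differs v x y * F v)
  sumᵛ-differs-≥ r1 n {x} {y} W F x≢y W-y worst = *-cancelˡ-≤ r (begin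
    r * (r1 * sumᵛ r n (λ v → W v * F v))
      ≡⟨ x∙yz≈y∙xz r r1 _ ⟩
    r1 * (r * sumᵛ r n (λ v → W v * F v))
      ≡⟨ cong (r1 *_) (sumᵛ-recolour r n y (λ v → W v * F v)) ⟨
    r1 * sumᵛ r n (λ v → ∑[ b < r ] (W (v [ y ]≔ b) * h v b))
      ≡⟨ sumᵛ-*ˡ r n r1 _ ⟨
    sumᵛ r n (λ v → r1 * ∑[ b < r ] (W (v [ y ]≔ b) * h v b))
      ≡⟨ sumᵛ-cong r n (λ v → cong (r1 *_) (trans (sum-cong-≗ (λ b → cong (_* h v b) (W-y v b)))
                                                  (sym (*-distribˡ-sum (W v) (h v))))) ⟩
    sumᵛ r n (λ v → r1 * (W v * sum (h v)))
      ≤⟨ sumᵛ-mono r n (λ v → ≤-trans (≤-reflexive (x∙yz≈y∙xz r1 (W v) _))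
                               (*-monoʳ-≤ (W v) (∑-without-minimum r1 (lookup v x) (h v) (worst v)))) ⟩
    sumᵛ r n (λ v → W v * (r * ∑[ b < r ] (differ (lookup v x) b * h v b)))
      ≡⟨ sumᵛ-cong r n (λ v → trans (x∙yz≈y∙xz (W v) r _)
                         (cong (r *_) (trans (*-distribˡ-sum (W v) (λ b → differ (lookup v x) b * h v b))
                                             (sum-cong-≗ (G-update v))))) ⟩
    sumᵛ r n (λ v → r * ∑[ b < r ] G (v [ y ]≔ b))
      ≡⟨ sumᵛ-*ˡ r n r _ ⟩
    r * sumᵛ r n (λ v → ∑[ b < r ] G (v [ y ]≔ b))
      ≡⟨ cong (r *_) (sumᵛ-recolour r n y G) ⟩
    r * (r * sumᵛ r n G) ∎)
    where
    open ≤-Reasoning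
    r = suc r1
    h : Colouring r n → Fin r → ℕ
    h v b = F (v [ y ]≔ b)
    G : Colouring r n → ℕ
    G v = W v * differs v x y * F v
    G-update : ∀ v b → W v * (differ (lookup v x) b * h v b) ≡ G (v [ y ]≔ b)
    G-update v b rewrite W-y v b | lookup∘update′ x≢y v b | lookup∘update y v b = sym (*-assoc (W v) _ _)

  -- Under the distribution on colourings proportional to the weight W, the edge e crosses with
  -- probability at least Z / M.
  record CrossingBound {r1 n} (e : Subset n) (M Z : ℕ) (W : Colouring (suc r1) n → ℕ) : Set where
    constructor crossingBound
    field
      mass-positive : 0 < sumᵛ (suc r1) n W
      bound         : sumᵛ (suc r1) n W * Z ≤ M * sumᵛ (suc r1) n (λ v → W v * crossing v e)

  crossingBound-cong : ∀ {r1 n} {e : Subset n} {M Z} {W W′ : Colouring (suc r1) n → ℕ} →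
    (∀ v → W v ≡ W′ v) → CrossingBound e M Z W → CrossingBound e M Z W′
  crossingBound-cong {r1} {n} {e} {M} {Z} W≗W′ (crossingBound pos bound) = crossingBound
    (subst (0 <_) (sumᵛ-cong (suc r1) n W≗W′) pos)
    (subst₂ (λ a b → a * Z ≤ M * b) (sumᵛ-cong (suc r1) n W≗W′)
           (sumᵛ-cong (suc r1) n (λ v → cong (_* crossing v e) (W≗W′ v))) bound)

  mass-differs : ∀ r1 n {x y : Fin n} (W : Colouring (suc r1) n → ℕ) → x ≢ y → Ignores W y →
    suc r1 * sumᵛ (suc r1) n (λ v → W v * differs v x y) ≡ r1 * sumᵛ (suc r1) n W
  mass-differs r1 n {x} {y} W x≢y W-y = begin
    suc r1 * sumᵛ (suc r1) n (λ v → W v * differs v x y)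
      ≡⟨ cong (suc r1 *_) (sumᵛ-cong (suc r1) n (λ v → sym (*-identityʳ (W v * differs v x y)))) ⟩
    suc r1 * sumᵛ (suc r1) n (λ v → W v * differs v x y * 1)
      ≡⟨ sumᵛ-differs r1 n W (λ _ → 1) x≢y W-y (λ _ _ → refl) ⟩
    r1 * sumᵛ (suc r1) n (λ v → W v * 1)
      ≡⟨ cong (r1 *_) (sumᵛ-cong (suc r1) n (λ v → *-identityʳ (W v))) ⟩
    r1 * sumᵛ (suc r1) n W ∎
    where open ≡-Reasoning

  -- Conditioning on x and y receiving different colours cannot lower the probability that e is cut:
  -- if y ∉ e (or x ∉ e) nothing changes, and otherwise the colour of x is the worst colour for y.
  crossing-differs : ∀ r1 n (e : Subset n) {x y : Fin n} (W : Colouring (suc r1) n → ℕ) →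
    x ≢ y → Ignores W x → Ignores W y →
    r1 * sumᵛ (suc r1) n (λ v → W v * crossing v e) ≤ suc r1 * sumᵛ (suc r1) n (λ v → W v * differs v x y * crossing v e)
  crossing-differs r1 n e {x} {y} W x≢y W-x W-y with lookup e y in ey
  ... | false = ≤-reflexive (sym (sumᵛ-differs r1 n W (λ v → crossing v e) x≢y W-y
                  (λ v b → cong boolToℕ (crosses-recolour-outside v e y b ey))))
  ... | true with lookup e x in ex
  ...   | false = ≤-reflexive (sym (trans
                    (cong (suc r1 *_) (sumᵛ-cong (suc r1) n (λ v →
                      cong (λ d → W v * d * crossing v e) (differ-sym (lookup v x) (lookup v y)))))
                    (sumᵛ-differs r1 n W (λ v → crossing v e) (x≢y ∘ sym) W-x
                      (λ v b → cong boolToℕ (crosses-recolour-outside v e x b ex)))))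
  ...   | true  = sumᵛ-differs-≥ r1 n W (λ v → crossing v e) x≢y W-y
                    (λ v b → boolToℕ-mono (crosses-recolour-duplicate v e b ex x≢y))

  crossingBound-differs : ∀ {r1 n} {e : Subset n} {M Z} {x y : Fin n} (W : Colouring (suc r1) n → ℕ) →
    1 ≤ r1 → x ≢ y → Ignores W x → Ignores W y →
    CrossingBound e M Z W → CrossingBound e M Z (λ v → W v * differs v x y)
  crossingBound-differs {r1} {n} {e} {M} {Z} {x} {y} W r1≥1 x≢y W-x W-y (crossingBound pos bound) =
    crossingBound pos′ (*-cancelˡ-≤ r (begin
      r * (N′ * Z)    ≡⟨ *-assoc r N′ Z ⟨
      r * N′ * Z      ≡⟨ cong (_* Z) (mass-differs r1 n W x≢y W-y) ⟩
      r1 * N * Z      ≡⟨ *-assoc r1 N Z ⟩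
      r1 * (N * Z)    ≤⟨ *-monoʳ-≤ r1 bound ⟩
      r1 * (M * Q)    ≡⟨ x∙yz≈y∙xz r1 M Q ⟩
      M * (r1 * Q)    ≤⟨ *-monoʳ-≤ M (crossing-differs r1 n e W x≢y W-x W-y) ⟩
      M * (r * Q′)    ≡⟨ x∙yz≈y∙xz M r Q′ ⟩
      r * (M * Q′)    ∎))
    where
    open ≤-Reasoning
    r  = suc r1
    N  = sumᵛ r n W
    N′ = sumᵛ r n (λ v → W v * differs v x y)
    Q  = sumᵛ r n (λ v → W v * crossing v e)
    Q′ = sumᵛ r n (λ v → W v * differs v x y * crossing v e)
    pos′ : 0 < N′
    pos′ = >-nonZero⁻¹ N′ {{m*n≢0⇒n≢0 r {{>-nonZero r·N′>0}}}}
      where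
      r·N′>0 : 0 < r * N′
      r·N′>0 = subst (0 <_) (sym (mass-differs r1 n W x≢y W-y)) (*-mono-≤ r1≥1 pos)

  Pair : ℕ → Set
  Pair n = Fin n × Fin n

  Disjoint : ∀ {n} → Pair n → Pair n → Set
  Disjoint (x , y) (x′ , y′) = x ≢ x′ × x ≢ y′ × y ≢ x′ × y ≢ y′

  record IsMatching {n} (matched : Pair n → Bool) : Set where
    field
      irreflexive : ∀ {x y} → matched (x , y) ≡ true → x ≢ y
      disjoint    : ∀ {p q} → matched p ≡ true → matched q ≡ true → p ≢ q → Disjoint p q

  module _ {n : ℕ} (matched : Pair n → Bool) where

    pairWeight : ∀ {r} → Pair n → Colouring r n → ℕ
    pairWeight (x , y) v = if matched (x , y) then differs v x y else 1

    matchingWeight : ∀ {r} → List (Pair n) → Colouring r n → ℕ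
    matchingWeight L v = foldr (λ p w → pairWeight p v * w) 1 L

    pairWeight-matched : ∀ {r x y} (v : Colouring r n) → matched (x , y) ≡ true → pairWeight (x , y) v ≡ differs v x y
    pairWeight-matched v m rewrite m = refl

    matchingWeight-absorbs : ∀ {r} L {x y} → (x , y) ∈ L → matched (x , y) ≡ true →
      ∀ (v : Colouring r n) → differs v x y * matchingWeight L v ≡ matchingWeight L v
    matchingWeight-absorbs ((x , y) ∷ L) (here refl) mxy v = begin
      d * (pairWeight (x , y) v * w)  ≡⟨ cong (λ p → d * (p * w)) (pairWeight-matched v mxy) ⟩
      d * (d * w)                     ≡⟨ *-assoc d d w ⟨
      d * d * w                       ≡⟨ cong (_* w) (differ-idem (lookup v x) (lookup v y)) ⟩
      d * w                           ≡⟨ cong (_* w) (pairWeight-matched v mxy) ⟨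
      pairWeight (x , y) v * w        ∎
      where
      open ≡-Reasoning
      d = differs v x y
      w = matchingWeight L v
    matchingWeight-absorbs (p ∷ L) {x} {y} (there x,y∈L) mxy v =
      trans (x∙yz≈y∙xz (differs v x y) (pairWeight p v) _)
            (cong (pairWeight p v *_) (matchingWeight-absorbs L x,y∈L mxy v))

    containsMatchedPair : List (Pair n) → Subset n → Bool
    containsMatchedPair L e = any (λ p → matched p ∧ (lookup e (proj₁ p) ∧ lookup e (proj₂ p))) L

  Absorbs : ∀ {r n} → (Colouring r n → ℕ) → Pair n → Set
  Absorbs W (x , y) = ∀ v → W v * differs v x y ≡ W v

  IgnoresBoth : ∀ {r n} → (Colouring r n → ℕ) → Pair n → Set
  IgnoresBoth W (x , y) = Ignores W x × Ignores W y

  differs-ignores : ∀ {r n} {x y : Fin n} (z : Fin n) → z ≢ x → z ≢ y → Ignores {r} (λ v → differs v x y) z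
  differs-ignores z z≢x z≢y v b rewrite lookup∘update′ (z≢x ∘ sym) v b | lookup∘update′ (z≢y ∘ sym) v b = refl

  ignores-* : ∀ {r n} {W W′ : Colouring r n → ℕ} {z} → Ignores W z → Ignores W′ z → Ignores (λ v → W v * W′ v) z
  ignores-* W-z W′-z v b = cong₂ _*_ (W-z v b) (W′-z v b)

  absorbs-self : ∀ {r n} (W : Colouring r n → ℕ) x y → Absorbs (λ v → W v * differs v x y) (x , y)
  absorbs-self W x y v = trans (*-assoc (W v) _ _) (cong (W v *_) (differ-idem (lookup v x) (lookup v y)))

  module _ {r n : ℕ} {matched : Pair n → Bool} (isMatching : IsMatching matched) where
    open IsMatching isMatching

    Ready : (Colouring r n → ℕ) → Set
    Ready W = ∀ p → matched p ≡ true → Absorbs W p ⊎ IgnoresBoth W p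

    ready-differs : ∀ W {x y} → matched (x , y) ≡ true → Ready W → Ready (λ v → W v * differs v x y)
    ready-differs W {x} {y} mxy ready (x′ , y′) m′ with (x′ , y′) ≟ᵖ (x , y) | ready (x′ , y′) m′
      where _≟ᵖ_ = ≡-dec _≟_ _≟_
    ... | yes refl | _ = inj₁ (absorbs-self W x y)
    ... | no  p≢q  | inj₁ absorbs = inj₁ (λ v → begin
      W v * differs v x y * differs v x′ y′   ≡⟨ xy∙z≈xz∙y (W v) _ _ ⟩
      W v * differs v x′ y′ * differs v x y   ≡⟨ cong (_* differs v x y) (absorbs v) ⟩
      W v * differs v x y                     ∎)
      where
      open ≡-Reasoning
    ... | no  p≢q  | inj₂ (W-x′ , W-y′) with disjoint m′ mxy p≢q
    ...   | x′≢x , x′≢y , y′≢x , y′≢y =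
      inj₂ (ignores-* W-x′ (differs-ignores x′ x′≢x x′≢y) , ignores-* W-y′ (differs-ignores y′ y′≢x y′≢y))

    ready-1 : Ready (λ _ → 1)
    ready-1 _ _ = inj₂ ((λ _ _ → refl) , (λ _ _ → refl))

  module _ {r1 n : ℕ} {e : Subset n} {M Z : ℕ} {matched : Pair n → Bool} (r1≥1 : 1 ≤ r1)
           (isMatching : IsMatching matched) where
    open IsMatching isMatching using (irreflexive)

    crossingBound-extend : ∀ L (W : Colouring (suc r1) n → ℕ) → Ready isMatching W → CrossingBound e M Z W →
      CrossingBound e M Z (λ v → W v * matchingWeight matched L v)
    crossingBound-extend [] W ready bound = crossingBound-cong (λ v → sym (*-identityʳ (W v))) bound
    crossingBound-extend ((x , y) ∷ L) W ready bound with matched (x , y) in mxy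
    ... | false = crossingBound-cong (λ v → cong (W v *_) (sym (*-identityˡ _)))
                    (crossingBound-extend L W ready bound)
    ... | true with ready (x , y) mxy
    ...   | inj₁ absorbs = crossingBound-cong (λ v →
              trans (cong (_* matchingWeight matched L v) (sym (absorbs v))) (*-assoc (W v) _ _))
            (crossingBound-extend L W ready bound)
    ...   | inj₂ (W-x , W-y) = crossingBound-cong (λ v → *-assoc (W v) _ _)
            (crossingBound-extend L (λ v → W v * differs v x y) (ready-differs isMatching W mxy ready)
              (crossingBound-differs W r1≥1 (irreflexive mxy) W-x W-y bound))

    crossingBound-matching : ∀ L → CrossingBound e M Z (λ _ → 1) → CrossingBound e M Z (matchingWeight matched L)
    crossingBound-matching L bound = crossingBound-cong (λ v → *-identityˡ _)
      (crossingBound-extend L (λ _ → 1) (ready-1 isMatching) bound)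

    crossingBound-matching-pair : ∀ L {x y} → (x , y) ∈ L → matched (x , y) ≡ true →
      CrossingBound e M Z (λ v → differs v x y) → CrossingBound e M Z (matchingWeight matched L)
    crossingBound-matching-pair L {x} {y} x,y∈L mxy bound =
      crossingBound-cong (λ v → trans (cong (_* _) (*-identityˡ (differs v x y)))
                                                      (matchingWeight-absorbs matched L x,y∈L mxy v))
        (crossingBound-extend L (λ v → 1 * differs v x y)
          (ready-differs isMatching (λ _ → 1) mxy (ready-1 isMatching))
          (crossingBound-cong (λ v → sym (*-identityˡ _)) bound))

  crossingBound-uniform : ∀ r1 n (e : Subset n) →
    CrossingBound {r1} e (suc r1 ^ ∣ e ∣ * r1) (r1 * covering (suc r1) ∣ e ∣ (suc r1)) (λ _ → 1)
  crossingBound-uniform r1 n e = crossingBound (subst (0 <_) (sym mass) (*-mono-≤ (m^n>0 r n) (s≤s z≤n))) (≤-reflexive (begin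
    sumᵛ r n (λ _ → 1) * (r1 * Hₖ)                 ≡⟨ cong (_* (r1 * Hₖ)) (trans mass (*-identityʳ (r ^ n))) ⟩
    r ^ n * (r1 * Hₖ)                              ≡⟨ x∙yz≈y∙xz (r ^ n) r1 Hₖ ⟩
    r1 * (r ^ n * Hₖ)                              ≡⟨ cong (r1 *_) (sumᵛ-crosses r n e) ⟨
    r1 * (r ^ k * sumᵛ r n (λ v → crossing v e))   ≡⟨ x∙yz≈y∙xz r1 (r ^ k) _ ⟩
    r ^ k * (r1 * sumᵛ r n (λ v → crossing v e))   ≡⟨ *-assoc (r ^ k) r1 _ ⟨
    r ^ k * r1 * sumᵛ r n (λ v → crossing v e)     ≡⟨ cong (r ^ k * r1 *_) (sumᵛ-cong r n (λ v → sym (*-identityˡ _))) ⟩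
    r ^ k * r1 * sumᵛ r n (λ v → 1 * crossing v e) ∎))
    where
    open ≡-Reasoning
    r = suc r1
    k = ∣ e ∣
    Hₖ = covering r k r
    mass : sumᵛ r n (λ _ → 1) ≡ r ^ n * 1
    mass = sumᵛ-const r n 1

  suc-pred-∣∣ : ∀ {n} (e : Subset n) {y} → lookup e y ≡ true → suc (pred ∣ e ∣) ≡ ∣ e ∣
  suc-pred-∣∣ e {y} ey = trans (cong (λ j → suc (pred j)) (sym (∣[]≔false∣ e y ey))) (∣[]≔false∣ e y ey)

  -- If x and y share a colour, y is redundant for crossing e.
  sumᵛ-agree-crossing : ∀ r n (e : Subset n) {x y} → lookup e x ≡ true → x ≢ y →
    r * sumᵛ r n (λ v → agree (lookup v x) (lookup v y) * crossing v e) ≡ sumᵛ r n (λ v → crossing v (e [ y ]≔ false))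
  sumᵛ-agree-crossing r n e {x} {y} ex x≢y = trans (sym (sumᵛ-recolour r n y F)) (sumᵛ-cong r n recoloured)
    where
    F : Colouring r n → ℕ
    F v = agree (lookup v x) (lookup v y) * crossing v e
    recoloured : ∀ v → ∑[ b < r ] F (v [ y ]≔ b) ≡ crossing v (e [ y ]≔ false)
    recoloured v = begin
      ∑[ b < r ] F (v [ y ]≔ b)                            ≡⟨ sum-cong-≗ F-update ⟩
      ∑[ b < r ] (agree (lookup v x) b * crossing (v [ y ]≔ b) e) ≡⟨ ∑-agree r (lookup v x) (λ b → crossing (v [ y ]≔ b) e) ⟩
      crossing w e                                         ≡⟨ cong boolToℕ (crosses-drop-duplicate w e ex x≢y w-y≡w-x) ⟩
      crossing w (e [ y ]≔ false)                          ≡⟨ cong boolToℕ (crosses-recolour-outside v (e [ y ]≔ false) y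
                                                                              (lookup v x) (lookup∘update y e false)) ⟩
      crossing v (e [ y ]≔ false)                          ∎
      where
      open ≡-Reasoning
      w = v [ y ]≔ lookup v x
      w-y≡w-x : lookup w y ≡ lookup w x
      w-y≡w-x = trans (lookup∘update y v (lookup v x)) (sym (lookup∘update′ x≢y v (lookup v x)))
      F-update : ∀ b → F (v [ y ]≔ b) ≡ agree (lookup v x) b * crossing (v [ y ]≔ b) e
      F-update b rewrite lookup∘update′ x≢y v b | lookup∘update y v b = refl

  sumᵛ-differs-crossing : ∀ r1 n (e : Subset n) {x y} → lookup e x ≡ true → lookup e y ≡ true → x ≢ y →
    suc r1 ^ ∣ e ∣ * sumᵛ (suc r1) n (λ v → differs v x y * crossing v e)
      ≡ suc r1 ^ n * (r1 * covering (suc r1) (pred ∣ e ∣) (suc r1) + suc r1 * covering r1 (pred ∣ e ∣) r1)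
  sumᵛ-differs-crossing r1 n e {x} {y} ex ey x≢y = +-cancelʳ-≡ (r ^ n * S) _ _ (begin
    r ^ k * A + r ^ n * S                      ≡⟨ cong (r ^ k * A +_) r^k·B ⟨
    r ^ k * A + r ^ k * B                      ≡⟨ *-distribˡ-+ (r ^ k) A B ⟨
    r ^ k * (A + B)                            ≡⟨ cong (r ^ k *_) A+B ⟩
    r ^ k * sumᵛ r n (λ v → crossing v e)      ≡⟨ sumᵛ-crosses r n e ⟩
    r ^ n * covering r k r                     ≡⟨ cong (λ j → r ^ n * covering r j r) k≡ ⟨
    r ^ n * covering r (suc k′) r              ≡⟨ cong (r ^ n *_) (surjections-suc r1 k′) ⟩
    r ^ n * (r * (S + S′))                     ≡⟨ regroup (r ^ n) r1 S S′ ⟩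
    r ^ n * (r1 * S + r * S′) + r ^ n * S      ∎)
    where
    open ≡-Reasoning
    r  = suc r1
    k  = ∣ e ∣
    k′ = pred k
    S  = covering r k′ r
    S′ = covering r1 k′ r1
    A  = sumᵛ r n (λ v → differs v x y * crossing v e)
    B  = sumᵛ r n (λ v → agree (lookup v x) (lookup v y) * crossing v e)
    k≡ : suc k′ ≡ k
    k≡ = suc-pred-∣∣ e ey
    A+B : A + B ≡ sumᵛ r n (λ v → crossing v e)
    A+B = trans (sym (sumᵛ-+ r n _ _)) (sumᵛ-cong r n (λ v →
      trans (sym (*-distribʳ-+ (crossing v e) (differs v x y) (agree (lookup v x) (lookup v y))))
            (trans (cong (_* crossing v e) (trans (+-comm (differs v x y) _) (agree+differ (lookup v x) (lookup v y))))
                   (*-identityˡ (crossing v e)))))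
    r^k·B : r ^ k * B ≡ r ^ n * S
    r^k·B = begin
      r ^ k * B                          ≡⟨ cong (λ j → r ^ j * B) k≡ ⟨
      r * r ^ k′ * B                     ≡⟨ xy∙z≈y∙xz r (r ^ k′) B ⟩
      r ^ k′ * (r * B)                   ≡⟨ cong (r ^ k′ *_) (sumᵛ-agree-crossing r n e ex x≢y) ⟩
      r ^ k′ * C′                        ≡⟨ cong (λ j → r ^ j * C′) ∣e′∣≡k′ ⟨
      r ^ ∣ e′ ∣ * C′                    ≡⟨ sumᵛ-crosses r n e′ ⟩
      r ^ n * covering r ∣ e′ ∣ r        ≡⟨ cong (λ j → r ^ n * covering r j r) ∣e′∣≡k′ ⟩
      r ^ n * S                          ∎
      where
      e′ = e [ y ]≔ false
      C′ = sumᵛ r n (λ v → crossing v e′)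
      ∣e′∣≡k′ : ∣ e′ ∣ ≡ k′
      ∣e′∣≡k′ = cong pred (∣[]≔false∣ e y ey)
    regroup : ∀ p r1 s z → p * (suc r1 * (s + z)) ≡ p * (r1 * s + suc r1 * z) + p * s
    regroup = solve-∀

  crossingBound-pair : ∀ r1 n (e : Subset n) {x y} → 1 ≤ r1 → lookup e x ≡ true → lookup e y ≡ true → x ≢ y →
    CrossingBound {r1} e (suc r1 ^ ∣ e ∣ * r1)
      (r1 * covering (suc r1) ∣ e ∣ (suc r1) + suc r1 * covering r1 (pred ∣ e ∣) r1) (λ v → differs v x y)
  crossingBound-pair r1 n e {x} {y} r1≥1 ex ey x≢y = crossingBound N>0 (≤-reflexive (*-cancelˡ-≡ _ _ r (begin
    r * (N * (r1 * covering r k r + r * S′))               ≡⟨ *-assoc r N _ ⟨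
    r * N * (r1 * covering r k r + r * S′)                 ≡⟨ cong₂ (λ a j → a * (r1 * covering r j r + r * S′)) (sym r·N) k≡ ⟨
    r1 * r ^ n * (r1 * covering r (suc k′) r + r * S′)     ≡⟨ cong (λ h → r1 * r ^ n * (r1 * h + r * S′)) (surjections-suc r1 k′) ⟩
    r1 * r ^ n * (r1 * (r * (S + S′)) + r * S′)            ≡⟨ regroup r1 (r ^ n) S S′ ⟩
    r * r1 * (r ^ n * (r1 * S + r * S′))                   ≡⟨ cong (r * r1 *_) (sumᵛ-differs-crossing r1 n e ex ey x≢y) ⟨
    r * r1 * (r ^ k * A)                                   ≡⟨ regroup′ r r1 (r ^ k) A ⟩
    r * (r ^ k * r1 * A)                                   ∎)))
    where
    open ≡-Reasoning
    r  = suc r1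
    k  = ∣ e ∣
    k′ = pred k
    S  = covering r k′ r
    S′ = covering r1 k′ r1
    N  = sumᵛ r n (λ v → differs v x y)
    A  = sumᵛ r n (λ v → differs v x y * crossing v e)
    k≡ : suc k′ ≡ k
    k≡ = suc-pred-∣∣ e ey
    r·N : r * N ≡ r1 * r ^ n
    r·N = begin
      r * N                            ≡⟨ cong (r *_) (sumᵛ-cong r n (λ v → sym (*-identityˡ _))) ⟩
      r * sumᵛ r n (λ v → 1 * differs v x y) ≡⟨ mass-differs r1 n (λ _ → 1) x≢y (λ _ _ → refl) ⟩
      r1 * sumᵛ r n (λ _ → 1)          ≡⟨ cong (r1 *_) (trans (sumᵛ-const r n 1) (*-identityʳ (r ^ n))) ⟩
      r1 * r ^ n                       ∎
    N>0 : 0 < N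
    N>0 = >-nonZero⁻¹ N {{m*n≢0⇒n≢0 r {{>-nonZero (subst (0 <_) (sym r·N) (*-mono-≤ r1≥1 (m^n>0 r n)))}}}}
    regroup : ∀ r1 p s z → r1 * p * (r1 * (suc r1 * (s + z)) + suc r1 * z) ≡ suc r1 * r1 * (p * (r1 * s + suc r1 * z))
    regroup = solve-∀
    regroup′ : ∀ r r1 p a → r * r1 * (p * a) ≡ r * (p * r1 * a)
    regroup′ = solve-∀

  countᵇ-∷ : ∀ {A : Set} (p : A → Bool) x xs → countᵇ p (x ∷ xs) ≡ boolToℕ (p x) + countᵇ p xs
  countᵇ-∷ p x xs with p x
  ... | true  = refl
  ... | false = refl

  countᵇ-crosses-∷ : ∀ {r n} (v : Colouring r n) e E →
    countᵇ (crossesᵇ (lookup v)) (e ∷ E) ≡ crossing v e + countᵇ (crossesᵇ (lookup v)) E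
  countᵇ-crosses-∷ v e E = trans (countᵇ-∷ _ e E) (cong (λ b → boolToℕ b + _) (crossesᵇ≡crosses v e))

  module _ {r1 n : ℕ} {matched : Pair n → Bool} (r1≥1 : 1 ≤ r1) (isMatching : IsMatching matched)
           (L : List (Pair n)) where

    private
      r = suc r1
      w : Colouring r n → ℕ
      w = matchingWeight matched L
      N = sumᵛ r n w

    crossingBound-edge : ∀ e → CrossingBound e (r ^ ∣ e ∣ * r1)
      (r1 * covering r ∣ e ∣ r + boolToℕ (containsMatchedPair matched L e) * (r * covering r1 (pred ∣ e ∣) r1)) w
    crossingBound-edge e with containsMatchedPair matched L e in δe
    ... | false = subst (λ Z → CrossingBound e (r ^ ∣ e ∣ * r1) Z w) (sym (+-identityʳ _))
                    (crossingBound-matching r1≥1 isMatching L (crossingBound-uniform r1 n e))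
    ... | true with any≡true⇒∃ _ L δe
    ...   | (x , y) , x,y∈L , found = subst (λ Z → CrossingBound e (r ^ ∣ e ∣ * r1) Z w)
              (cong (r1 * covering r ∣ e ∣ r +_) (sym (*-identityˡ _)))
              (crossingBound-matching-pair r1≥1 isMatching L x,y∈L mxy
                (crossingBound-pair r1 n e r1≥1 ex ey (IsMatching.irreflexive isMatching mxy)))
      where
      mxy = ∧-conicalˡ (matched (x , y)) _ found
      ex  = ∧-conicalˡ (lookup e x) _ (∧-conicalʳ (matched (x , y)) _ found)
      ey  = ∧-conicalʳ (lookup e x) _ (∧-conicalʳ (matched (x , y)) _ found)

    matchingWeight-positive : 0 < N
    matchingWeight-positive = CrossingBound.mass-positive (crossingBound-matching r1≥1 isMatching L (crossingBound-uniform r1 n ⊥))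

    sumᵛ-cuts : ∀ k (E : List (Subset n)) → All (λ e → ∣ e ∣ ≡ k) E →
      N * (length E * (r1 * covering r k r) + r * covering r1 (pred k) r1 * countᵇ (containsMatchedPair matched L) E)
        ≤ r ^ k * r1 * sumᵛ r n (λ v → w v * countᵇ (crossesᵇ (lookup v)) E)
    sumᵛ-cuts k [] [] = ≤-trans (≤-reflexive (trans (cong (N *_) (*-zeroʳ (r * covering r1 (pred k) r1))) (*-zeroʳ N))) z≤n
    sumᵛ-cuts k (e ∷ E) (∣e∣≡k ∷ ∣E∣≡k) = begin
      N * (suc (length E) * a + b * countᵇ δ (e ∷ E))
        ≡⟨ cong (λ c → N * (suc (length E) * a + b * c)) (countᵇ-∷ δ e E) ⟩
      N * (suc (length E) * a + b * (boolToℕ (δ e) + countᵇ δ E))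
        ≡⟨ regroup N a b (boolToℕ (δ e)) (length E) (countᵇ δ E) ⟩
      N * (a + boolToℕ (δ e) * b) + N * (length E * a + b * countᵇ δ E)
        ≤⟨ +-mono-≤ edge (sumᵛ-cuts k E ∣E∣≡k) ⟩
      M * sumᵛ r n (λ v → w v * crossing v e) + M * sumᵛ r n (λ v → w v * countᵇ (crossesᵇ (lookup v)) E)
        ≡⟨ *-distribˡ-+ M _ _ ⟨
      M * (sumᵛ r n (λ v → w v * crossing v e) + sumᵛ r n (λ v → w v * countᵇ (crossesᵇ (lookup v)) E))
        ≡⟨ cong (M *_) (sumᵛ-+ r n _ _) ⟨
      M * sumᵛ r n (λ v → w v * crossing v e + w v * countᵇ (crossesᵇ (lookup v)) E)
        ≡⟨ cong (M *_) (sumᵛ-cong r n (λ v → trans (sym (*-distribˡ-+ (w v) _ _))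
                                                 (cong (w v *_) (sym (countᵇ-crosses-∷ v e E))))) ⟩
      M * sumᵛ r n (λ v → w v * countᵇ (crossesᵇ (lookup v)) (e ∷ E)) ∎
      where
      open ≤-Reasoning
      δ = containsMatchedPair matched L
      a = r1 * covering r k r
      b = r * covering r1 (pred k) r1
      M = r ^ k * r1
      edge : N * (a + boolToℕ (δ e) * b) ≤ M * sumᵛ r n (λ v → w v * crossing v e)
      edge = subst (λ j → N * (r1 * covering r j r + boolToℕ (δ e) * (r * covering r1 (pred j) r1))
                            ≤ r ^ j * r1 * sumᵛ r n (λ v → w v * crossing v e))
                   ∣e∣≡k (CrossingBound.bound (crossingBound-edge e))
      regroup : ∀ N a b d l c → N * (suc l * a + b * (d + c)) ≡ N * (a + d * b) + N * (l * a + b * c)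
      regroup = solve-∀

    large-cut : ∀ k (E : List (Subset n)) → All (λ e → ∣ e ∣ ≡ k) E → ∃ λ (v : Colouring r n) →
      r1 * (stirling2 k r * r ! * length E) + r * covering r1 (pred k) r1 * countᵇ (containsMatchedPair matched L) E
        ≤ r1 * (r ^ k * countᵇ (crossesᵇ (lookup v)) E)
    large-cut k E ∣E∣≡k with weighted-average-attained r n w (λ v → r ^ k * r1 * countᵇ (crossesᵇ (lookup v)) E) _
      matchingWeight-positive
      (≤-trans (sumᵛ-cuts k E ∣E∣≡k) (≤-reflexive (trans (sym (sumᵛ-*ˡ r n (r ^ k * r1) _))
        (sumᵛ-cong r n (λ v → x∙yz≈y∙xz (r ^ k * r1) (w v) _)))))
    ... | v , average≤ = v , subst₂ (λ a b → a + r * covering r1 (pred k) r1 * countᵇ (containsMatchedPair matched L) E ≤ b)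
      (trans (cong (λ h → length E * (r1 * h)) (surjections≡!*stirling2 k r)) (regroup₁ (length E) r1 (r !) (stirling2 k r)))
      (regroup₂ (r ^ k) r1 (countᵇ (crossesᵇ (lookup v)) E))
      average≤
      where
      regroup₁ : ∀ m r1 f s → m * (r1 * (f * s)) ≡ r1 * (s * f * m)
      regroup₁ = solve-∀
      regroup₂ : ∀ p r1 c → p * r1 * c ≡ r1 * (p * c)
      regroup₂ = solve-∀

  -- Matchings of the vertices outside U by rank

  rank : ∀ {n} → Subset n → Fin n → ℕ
  rank (x ∷ W) zero    = 0
  rank (x ∷ W) (suc i) = boolToℕ x + rank W i

  rank<∣∣ : ∀ {n} (W : Subset n) x → lookup W x ≡ true → rank W x < ∣ W ∣
  rank<∣∣ (true  ∷ W) zero    _  = s≤s z≤n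
  rank<∣∣ (true  ∷ W) (suc i) Wx = s≤s (rank<∣∣ W i Wx)
  rank<∣∣ (false ∷ W) (suc i) Wx = rank<∣∣ W i Wx

  rank-injective : ∀ {n} (W : Subset n) {x y} → lookup W x ≡ true → lookup W y ≡ true → rank W x ≡ rank W y → x ≡ y
  rank-injective (true ∷ W) {zero}  {zero}  _  _  _  = refl
  rank-injective (true ∷ W) {zero}  {suc j} _  _  ()
  rank-injective (true ∷ W) {suc i} {zero}  _  _  ()
  rank-injective (b ∷ W)    {suc i} {suc j} Wx Wy eq = cong suc (rank-injective W Wx Wy (+-cancelˡ-≡ (boolToℕ b) _ _ eq))

  -- For fixed s the pairs of W with rank sum s are disjoint, and every pair of W lies in one of these
  -- 2 |W| matchings.
  rankMatching : ∀ {n} → Subset n → ℕ → Pair n → Bool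
  rankMatching W s (x , y) = lookup W x ∧ (lookup W y ∧ (⌊ rank W x <? rank W y ⌋ ∧ ⌊ rank W x + rank W y ≟ℕ s ⌋))

  record RankMatched {n} (W : Subset n) (s : ℕ) (x y : Fin n) : Set where
    field
      x∈W  : lookup W x ≡ true
      y∈W  : lookup W y ≡ true
      x<y  : rank W x < rank W y
      x+y≡s : rank W x + rank W y ≡ s

  rankMatching-sound : ∀ {n} (W : Subset n) s {x y} → rankMatching W s (x , y) ≡ true → RankMatched W s x y
  rankMatching-sound W s {x} {y} h = record
    { x∈W  = ∧-conicalˡ (lookup W x) _ h
    ; y∈W  = ∧-conicalˡ (lookup W y) _ h₁
    ; x<y  = ⌊⌋≡true⇒ (rank W x <? rank W y) (∧-conicalˡ _ _ h₂)
    ; x+y≡s = ⌊⌋≡true⇒ (rank W x + rank W y ≟ℕ s) (∧-conicalʳ _ _ h₂) }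
    where
    h₁ = ∧-conicalʳ (lookup W x) _ h
    h₂ = ∧-conicalʳ (lookup W y) _ h₁

  rankMatching-complete : ∀ {n} (W : Subset n) {x y} → lookup W x ≡ true → lookup W y ≡ true → rank W x < rank W y →
    rankMatching W (rank W x + rank W y) (x , y) ≡ true
  rankMatching-complete W {x} {y} Wx Wy x<y rewrite Wx | Wy
    | ⇒⌊⌋≡true (rank W x <? rank W y) x<y | ⇒⌊⌋≡true (rank W x + rank W y ≟ℕ (rank W x + rank W y)) refl = refl

  rankMatching-isMatching : ∀ {n} (W : Subset n) s → IsMatching (rankMatching W s)
  rankMatching-isMatching W s = record
    { irreflexive = λ h x≡y → <-irrefl (cong (rank W) x≡y) (RankMatched.x<y (rankMatching-sound W s h))
    ; disjoint    = disjoint }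
    where
    disjoint : ∀ {p q} → rankMatching W s p ≡ true → rankMatching W s q ≡ true → p ≢ q → Disjoint p q
    disjoint {x , y} {x′ , y′} hp hq p≢q = x≢x′ , x≢y′ , y≢x′ , y≢y′
      where
      open RankMatched (rankMatching-sound W s hp)
      open RankMatched (rankMatching-sound W s hq) renaming (x∈W to x′∈W; y∈W to y′∈W; x<y to x′<y′; x+y≡s to x′+y′≡s)
      sums : rank W x + rank W y ≡ rank W x′ + rank W y′
      sums = trans x+y≡s (sym x′+y′≡s)
      x≢x′ : x ≢ x′
      x≢x′ refl = p≢q (cong (x ,_) (rank-injective W y∈W y′∈W (+-cancelˡ-≡ (rank W x) _ _ sums)))
      y≢y′ : y ≢ y′
      y≢y′ refl = p≢q (cong (_, y) (rank-injective W x∈W x′∈W (+-cancelʳ-≡ (rank W y) _ _ sums)))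
      x≢y′ : x ≢ y′
      x≢y′ refl = <-asym x′<y′ (subst (rank W x <_) y≡x′ x<y)
        where
        y≡x′ : rank W y ≡ rank W x′
        y≡x′ = +-cancelˡ-≡ (rank W x) _ _ (trans sums (+-comm (rank W x′) (rank W x)))
      y≢x′ : y ≢ x′
      y≢x′ refl = <-asym x<y (subst (rank W y <_) y′≡x x′<y′)
        where
        y′≡x : rank W y′ ≡ rank W x
        y′≡x = +-cancelˡ-≡ (rank W y) _ _ (trans (sym sums) (+-comm (rank W x) (rank W y)))

  allPairs : ∀ n → List (Pair n)
  allPairs n = cartesianProduct (allFin n) (allFin n)

  ∈-allPairs : ∀ {n} (p : Pair n) → p ∈ allPairs n
  ∈-allPairs (x , y) = ∈-cartesianProduct⁺ (∈-allFin x) (∈-allFin y)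

  ∣∩∣+∣∩∁∣ : ∀ {n} (e U : Subset n) → ∣ e ∩ U ∣ + ∣ e ∩ ∁ U ∣ ≡ ∣ e ∣
  ∣∩∣+∣∩∁∣ []         []          = refl
  ∣∩∣+∣∩∁∣ (true ∷ e)  (true ∷ U)  = cong suc (∣∩∣+∣∩∁∣ e U)
  ∣∩∣+∣∩∁∣ (true ∷ e)  (false ∷ U) = trans (+-suc _ _) (cong suc (∣∩∣+∣∩∁∣ e U))
  ∣∩∣+∣∩∁∣ (false ∷ e) (u ∷ U)     = ∣∩∣+∣∩∁∣ e U

  lookup-∩ : ∀ {n} (e W : Subset n) x → lookup (e ∩ W) x ≡ true → lookup e x ≡ true × lookup W x ≡ true
  lookup-∩ e W x h = ∧-conicalˡ (lookup e x) _ h′ , ∧-conicalʳ (lookup e x) _ h′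
    where h′ = trans (sym (lookup-zipWith _∧_ x e W)) h

  element : ∀ {n} (p : Subset n) → 1 ≤ ∣ p ∣ → ∃ λ x → lookup p x ≡ true
  element (true  ∷ p) _ = zero , refl
  element (false ∷ p) h with element p h
  ... | x , px = suc x , px

  two-elements : ∀ {n} (p : Subset n) → 2 ≤ ∣ p ∣ → ∃₂ λ x y → x ≢ y × lookup p x ≡ true × lookup p y ≡ true
  two-elements (true ∷ p) (s≤s h) with element p h
  ... | y , py = zero , suc y , (λ ()) , refl , py
  two-elements (false ∷ p) h with two-elements p h
  ... | x , y , x≢y , px , py = suc x , suc y , x≢y ∘ suc-injectiveᶠ , px , py

  matched-pair-in-edge : ∀ {n} (W e : Subset n) {x y} → lookup e x ≡ true → lookup e y ≡ true →
    lookup W x ≡ true → lookup W y ≡ true → rank W x < rank W y →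
    ∃ λ (s : Fin (∣ W ∣ + ∣ W ∣)) → containsMatchedPair (rankMatching W (toℕ s)) (allPairs n) e ≡ true
  matched-pair-in-edge {n} W e {x} {y} ex ey Wx Wy x<y =
    fromℕ< s<2∣W∣ , subst (λ s → containsMatchedPair (rankMatching W s) (allPairs n) e ≡ true) (sym (toℕ-fromℕ< s<2∣W∣))
      (∈⇒any≡true _ (∈-allPairs (x , y)) (subst (λ b → b ∧ (lookup e x ∧ lookup e y) ≡ true)
        (sym (rankMatching-complete W Wx Wy x<y)) (subst (λ b → b ∧ lookup e y ≡ true) (sym ex) ey)))
    where
    s<2∣W∣ : rank W x + rank W y < ∣ W ∣ + ∣ W ∣
    s<2∣W∣ = +-mono-< (rank<∣∣ W x Wx) (rank<∣∣ W y Wy)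

  mostlyInᵇ : ∀ {n} → ℕ → Subset n → Subset n → Bool
  mostlyInᵇ k U e = (k ∸ 1) ≤ᵇ ∣ e ∩ U ∣

  two-outside : ∀ {n} (U : Subset n) k (e : Subset n) → ∣ e ∣ ≡ k → mostlyInᵇ k U e ≡ false → 2 ≤ ∣ e ∩ ∁ U ∣
  two-outside U k e ∣e∣≡k not-mostly with 2 ≤? ∣ e ∩ ∁ U ∣
  ... | yes 2≤ = 2≤
  ... | no  2≰ = ⊥-elim (subst T not-mostly (≤⇒≤ᵇ (begin
    k ∸ 1                          ≡⟨ cong (_∸ 1) (trans (sym ∣e∣≡k) (sym (∣∩∣+∣∩∁∣ e U))) ⟩
    ∣ e ∩ U ∣ + ∣ e ∩ ∁ U ∣ ∸ 1    ≤⟨ ∸-monoˡ-≤ 1 (+-monoʳ-≤ ∣ e ∩ U ∣ (≤-pred (≰⇒> 2≰))) ⟩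
    ∣ e ∩ U ∣ + 1 ∸ 1              ≡⟨ m+n∸n≡m ∣ e ∩ U ∣ 1 ⟩
    ∣ e ∩ U ∣                      ∎)))
    where open ≤-Reasoning

  bad-edge⇒matched-pair : ∀ {n} (U : Subset n) k (e : Subset n) → ∣ e ∣ ≡ k → mostlyInᵇ k U e ≡ false →
    ∃ λ (s : Fin (∣ ∁ U ∣ + ∣ ∁ U ∣)) → containsMatchedPair (rankMatching (∁ U) (toℕ s)) (allPairs n) e ≡ true
  bad-edge⇒matched-pair {n} U k e ∣e∣≡k not-mostly with two-elements (e ∩ ∁ U) (two-outside U k e ∣e∣≡k not-mostly)
  ... | x , y , x≢y , x∈ , y∈ with lookup-∩ e (∁ U) x x∈ | lookup-∩ e (∁ U) y y∈
  ...   | ex , Wx | ey , Wy with <-cmp (rank (∁ U) x) (rank (∁ U) y)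
  ...     | tri< x<y _ _ = matched-pair-in-edge (∁ U) e ex ey Wx Wy x<y
  ...     | tri≈ _ x≡y _ = ⊥-elim (x≢y (rank-injective (∁ U) Wx Wy x≡y))
  ...     | tri> _ _ y<x = matched-pair-in-edge (∁ U) e ey ex Wy Wx y<x

  countᵇ-≤-∑ : ∀ {A : Set} {K} (bad : A → Bool) (δ : Fin K → A → Bool) (E : List A) →
    All (λ e → bad e ≡ true → ∃ λ s → δ s e ≡ true) E → countᵇ bad E ≤ ∑[ s < K ] countᵇ (δ s) E
  countᵇ-≤-∑ bad δ [] [] = z≤n
  countᵇ-≤-∑ {K = K} bad δ (e ∷ E) (covered ∷ all-covered) = begin
    countᵇ bad (e ∷ E)                                              ≡⟨ countᵇ-∷ bad e E ⟩
    boolToℕ (bad e) + countᵇ bad E                                  ≤⟨ +-mono-≤ head≤ (countᵇ-≤-∑ bad δ E all-covered) ⟩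
    ∑[ s < K ] boolToℕ (δ s e) + ∑[ s < K ] countᵇ (δ s) E          ≡⟨ ∑-distrib-+ (λ s → boolToℕ (δ s e)) (λ s → countᵇ (δ s) E) ⟨
    ∑[ s < K ] (boolToℕ (δ s e) + countᵇ (δ s) E)                   ≡⟨ sum-cong-≗ (λ s → countᵇ-∷ (δ s) e E) ⟨
    ∑[ s < K ] countᵇ (δ s) (e ∷ E)                                 ∎
    where
    open ≤-Reasoning
    head≤ : boolToℕ (bad e) ≤ ∑[ s < K ] boolToℕ (δ s e)
    head≤ with bad e
    ... | false = z≤n
    ... | true  = let (s , δse) = covered refl in
      ≤-trans (≤-reflexive (cong boolToℕ (sym δse))) (∑-term (λ s → boolToℕ (δ s e)) s)

  countᵇ+countᵇ-not : ∀ {A : Set} (p : A → Bool) (xs : List A) → countᵇ p xs + countᵇ (not ∘ p) xs ≡ length xs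
  countᵇ+countᵇ-not p []       = refl
  countᵇ+countᵇ-not p (x ∷ xs) with p x
  ... | true  = cong suc (countᵇ+countᵇ-not p xs)
  ... | false = trans (+-suc _ _) (cong suc (countᵇ+countᵇ-not p xs))

  gain⇒excess : ∀ r1 c X Q G → 1 ≤ r1 → 1 ≤ c → r1 * X + c * G ≤ r1 * Q → X ≤ Q × G ≤ r1 * (Q ∸ X)
  gain⇒excess r1 c X Q G r1≥1 c≥1 gain = X≤Q , (begin
    G                         ≤⟨ m≤n*m G c {{>-nonZero c≥1}} ⟩
    c * G                     ≡⟨ m+n∸m≡n (r1 * X) (c * G) ⟨
    r1 * X + c * G ∸ r1 * X   ≤⟨ ∸-monoˡ-≤ (r1 * X) gain ⟩
    r1 * Q ∸ r1 * X           ≡⟨ *-distribˡ-∸ r1 Q X ⟨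
    r1 * (Q ∸ X)              ∎)
    where
    open ≤-Reasoning
    X≤Q : X ≤ Q
    X≤Q = *-cancelˡ-≤ r1 {{>-nonZero r1≥1}} (≤-trans (m≤m+n (r1 * X) (c * G)) gain)

  -- Pigeonhole: every edge not mostly in U meets one of the 2 |∁ U| rank matchings.
  bad-edges-concentrate : ∀ {n} k (U : Subset n) (E : List (Subset n)) → All (λ e → ∣ e ∣ ≡ k) E →
    1 ≤ countᵇ (not ∘ mostlyInᵇ k U) E →
    ∃ λ (s : Fin (∣ ∁ U ∣ + ∣ ∁ U ∣)) → countᵇ (not ∘ mostlyInᵇ k U) E
      ≤ (∣ ∁ U ∣ + ∣ ∁ U ∣) * countᵇ (containsMatchedPair (rankMatching (∁ U) (toℕ s)) (allPairs n)) E
  bad-edges-concentrate {n} k U E ∣E∣≡k bad≥1 =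
    let (s , ∑≤G) = ∑≤*max G s₀ in s , ≤-trans bad≤∑ ∑≤G
    where
    G : Fin (∣ ∁ U ∣ + ∣ ∁ U ∣) → ℕ
    G s = countᵇ (containsMatchedPair (rankMatching (∁ U) (toℕ s)) (allPairs n)) E
    bad≤∑ : countᵇ (not ∘ mostlyInᵇ k U) E ≤ sum G
    bad≤∑ = countᵇ-≤-∑ _ _ E (All.map (λ {e} ∣e∣≡k bad → bad-edge⇒matched-pair U k e ∣e∣≡k (not≡true bad)) ∣E∣≡k)
      where
      not≡true : ∀ {b} → not b ≡ true → b ≡ false
      not≡true {false} _ = refl
    s₀ = proj₁ (∑-positive G (≤-trans bad≥1 bad≤∑))

  countᵇ-minority : ∀ {A : Set} (p : A → Bool) (xs : List A) → 2 * countᵇ p xs < length xs →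
    countᵇ p xs < countᵇ (not ∘ p) xs × length xs ≤ 2 * countᵇ (not ∘ p) xs
  countᵇ-minority p xs 2·hits<len =
    hits<misses , subst₂ _≤_ hits+misses (cong (misses +_) (sym (+-identityʳ misses))) (+-monoˡ-≤ misses (<⇒≤ hits<misses))
    where
    hits   = countᵇ p xs
    misses = countᵇ (not ∘ p) xs
    hits+misses : hits + misses ≡ length xs
    hits+misses = countᵇ+countᵇ-not p xs
    hits<misses : hits < misses
    hits<misses = +-cancelˡ-< hits hits misses (subst₂ _<_ (cong (hits +_) (+-identityʳ hits)) (sym hits+misses) 2·hits<len)

  many-bad-edges⇒large-excess : ∀ r1 k {n} → 1 ≤ r1 → suc r1 ≤ k → (H : MultiHypergraph k n) (U : Subset n) (b : ℕ) →
    ∣ U ∣ + b ≡ n → 2 * edgesMostlyIn H U < numEdges H →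
    0 < b × ∃ λ (v : Colouring (suc r1) n) →
      let P = suc r1 ^ k
          X = stirling2 k (suc r1) * suc r1 ! * numEdges H
          Q = P * cutSize H (lookup v)
      in X ≤ Q × numEdges H * P ≤ b * (Q ∸ X) * suc (4 * P * r1)
  many-bad-edges⇒large-excess (suc r2) k@(suc (suc j)) {n} r1≥1 (s≤s (s≤s r2≤j)) H U b ∣U∣+b≡n 2·mostly<m =
    subst (0 <_) B≡b (half-positive s) , v , X≤Q , (begin
      m * P                        ≤⟨ *-monoˡ-≤ P m≤2·bad ⟩
      2 * bad * P                  ≤⟨ *-monoˡ-≤ P (*-monoʳ-≤ 2 (≤-trans bad≤ (*-monoʳ-≤ (B + B) G≤))) ⟩
      2 * ((B + B) * (r1 * Y)) * P ≡⟨ regroup B r1 Y P ⟩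
      B * Y * (4 * P * r1)         ≤⟨ *-monoʳ-≤ (B * Y) (n≤1+n _) ⟩
      B * Y * suc (4 * P * r1)     ≡⟨ cong (λ a → a * Y * suc (4 * P * r1)) B≡b ⟩
      b * Y * suc (4 * P * r1)     ∎)
    where
    open ≤-Reasoning
    regroup : ∀ b r1 y p → 2 * ((b + b) * (r1 * y)) * p ≡ b * y * (4 * p * r1)
    regroup = solve-∀
    half-positive : ∀ {b} → Fin (b + b) → 0 < b
    half-positive {suc b} _ = s≤s z≤n
    r1 = suc r2
    r  = suc r1
    P  = r ^ k
    E  = edges H
    m  = numEdges H
    B  = ∣ ∁ U ∣
    B≡b : B ≡ b
    B≡b = trans (∣∁p∣≡n∸∣p∣ U) (trans (cong (_∸ ∣ U ∣) (sym ∣U∣+b≡n)) (m+n∸m≡n ∣ U ∣ b))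
    bad = countᵇ (not ∘ mostlyInᵇ k U) E
    majority = countᵇ-minority (mostlyInᵇ k U) E 2·mostly<m
    m≤2·bad = proj₂ majority
    concentrated = bad-edges-concentrate k U E (uniform H) (≤-trans (s≤s z≤n) (proj₁ majority))
    s = proj₁ concentrated
    G = countᵇ (containsMatchedPair (rankMatching (∁ U) (toℕ s)) (allPairs n)) E
    bad≤ : bad ≤ (B + B) * G
    bad≤ = proj₂ concentrated
    cut = large-cut r1≥1 (rankMatching-isMatching (∁ U) (toℕ s)) (allPairs n) k E (uniform H)
    v = proj₁ cut
    X = stirling2 k r * r ! * m
    Q = P * cutSize H (lookup v)
    Y = Q ∸ X
    excess = gain⇒excess r1 (r * covering r1 (pred k) r1) X Q G r1≥1
      (*-mono-≤ {1} {r} (s≤s z≤n) (surjections-positive r2 j r2≤j)) (proj₂ cut)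
    X≤Q = proj₁ excess
    G≤ : G ≤ r1 * Y
    G≤ = proj₂ excess

module RationalBounds where

  open import Data.Nat as ℕ using (ℕ; suc; NonZero)
  import Data.Nat.Properties as ℕ
  open import Data.Integer as ℤ using (+_; +≤+)
  import Data.Integer.Properties as ℤ
  open import Data.Integer.Tactic.RingSolver using (solve-∀)
  open import Data.Rational using (ℚ; _/_; _-_; _*_; toℚᵘ; fromℚᵘ; 0ℚ) renaming (_≤_ to _≤ℚ_; _<_ to _<ℚ_)
  open import Data.Rational.Properties
    using (toℚᵘ-cancel-≤; toℚᵘ-homo-*; toℚᵘ-homo-+; toℚᵘ-homo‿-; toℚᵘ-fromℚᵘ; positive⁻¹; normalize-pos)
  open import Data.Rational.Unnormalised as ℚᵘ using (mkℚᵘ; *≤*) renaming (_≃_ to _≃ᵘ_)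
  import Data.Rational.Unnormalised.Properties as ℚᵘ
  open import Relation.Binary.PropositionalEquality
  open import Defs using (ℕ→ℚ)

  1/suc : ℕ → ℚ
  1/suc d = fromℚᵘ (mkℚᵘ (+ 1) d)

  1/suc-positive : ∀ d → 0ℚ <ℚ 1/suc d
  1/suc-positive d = positive⁻¹ (1/suc d) {{normalize-pos 1 (suc d)}}

  toℚᵘ-ℕ→ℚ : ∀ a → toℚᵘ (ℕ→ℚ a) ≃ᵘ mkℚᵘ (+ a) 0
  toℚᵘ-ℕ→ℚ a = toℚᵘ-fromℚᵘ (mkℚᵘ (+ a) 0)

  toℚᵘ-1/suc-* : ∀ d m → toℚᵘ (1/suc d * ℕ→ℚ m) ≃ᵘ mkℚᵘ (+ 1) d ℚᵘ.* mkℚᵘ (+ m) 0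
  toℚᵘ-1/suc-* d m = ℚᵘ.≃-trans (toℚᵘ-homo-* (1/suc d) (ℕ→ℚ m))
    (ℚᵘ.*-cong (toℚᵘ-fromℚᵘ (mkℚᵘ (+ 1) d)) (toℚᵘ-ℕ→ℚ m))

  1/suc-*-≤ : ∀ d m a → m ℕ.≤ suc d ℕ.* a → 1/suc d * ℕ→ℚ m ≤ℚ ℕ→ℚ a
  1/suc-*-≤ d m a m≤ = toℚᵘ-cancel-≤ (ℚᵘ.≤-respˡ-≃ (ℚᵘ.≃-sym (toℚᵘ-1/suc-* d m))
    (ℚᵘ.≤-respʳ-≃ (ℚᵘ.≃-sym (toℚᵘ-ℕ→ℚ a))
      (*≤* (subst₂ ℤ._≤_ (sym lhs) (sym rhs) (+≤+ (ℕ.≤-trans m≤ (ℕ.≤-reflexive (ℕ.*-comm (suc d) a))))))))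
    where
    lhs : ℤ.+ 1 ℤ.* + m ℤ.* + 1 ≡ + m
    lhs = trans (ℤ.*-identityʳ _) (ℤ.*-identityˡ (+ m))
    rhs : + a ℤ.* + (suc d ℕ.* 1) ≡ + (a ℕ.* suc d)
    rhs = trans (sym (ℤ.pos-* a (suc d ℕ.* 1))) (cong (λ z → + (a ℕ.* z)) (ℕ.*-identityʳ (suc d)))

  1/suc-*-≤-*-minus : ∀ d m b c X Y q .{{_ : NonZero q}} → X ℕ.+ Y ≡ q ℕ.* c → m ℕ.* q ℕ.≤ b ℕ.* Y ℕ.* suc d →
    1/suc d * ℕ→ℚ m ≤ℚ ℕ→ℚ b * (ℕ→ℚ c - (+ X) / q)
  1/suc-*-≤-*-minus d m b c X Y (suc p) X+Y≡ m·p≤ = toℚᵘ-cancel-≤ (ℚᵘ.≤-respˡ-≃ (ℚᵘ.≃-sym (toℚᵘ-1/suc-* d m))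
    (ℚᵘ.≤-respʳ-≃ (ℚᵘ.≃-sym toℚᵘ-rhs) (*≤* (subst₂ ℤ._≤_ (sym lhs) (sym rhs) (+≤+ m·p≤)))))
    where
    A = mkℚᵘ (+ 1) d ℚᵘ.* mkℚᵘ (+ m) 0
    B = mkℚᵘ (+ b) 0 ℚᵘ.* (mkℚᵘ (+ c) 0 ℚᵘ.+ ℚᵘ.- mkℚᵘ (+ X) p)
    toℚᵘ-rhs : toℚᵘ (ℕ→ℚ b * (ℕ→ℚ c - (+ X) / suc p)) ≃ᵘ B
    toℚᵘ-rhs = ℚᵘ.≃-trans (toℚᵘ-homo-* (ℕ→ℚ b) _) (ℚᵘ.*-cong (toℚᵘ-ℕ→ℚ b)
      (ℚᵘ.≃-trans (toℚᵘ-homo-+ (ℕ→ℚ c) _) (ℚᵘ.+-cong (toℚᵘ-ℕ→ℚ c)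
        (ℚᵘ.≃-trans (toℚᵘ-homo‿- ((+ X) / suc p)) (ℚᵘ.-‿cong (toℚᵘ-fromℚᵘ (mkℚᵘ (+ X) p)))))))
    c·p≡ : + c ℤ.* + suc p ≡ + X ℤ.+ + Y
    c·p≡ = trans (sym (ℤ.pos-* c (suc p))) (trans (cong +_ (trans (ℕ.*-comm c (suc p)) (sym X+Y≡))) (ℤ.pos-+ X Y))
    lhs : ℚᵘ.↥ A ℤ.* ℚᵘ.↧ B ≡ + (m ℕ.* suc p)
    lhs = trans (cong₂ ℤ._*_ (ℤ.*-identityˡ (+ m)) (cong +_ (trans (ℕ.*-identityˡ _) (ℕ.*-identityˡ (suc p)))))
                (sym (ℤ.pos-* m (suc p)))
    cancel-X : ∀ (b x y q : ℤ.ℤ) → b ℤ.* ((x ℤ.+ y) ℤ.+ (ℤ.- x) ℤ.* + 1) ℤ.* q ≡ b ℤ.* y ℤ.* q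
    cancel-X = solve-∀
    rhs : ℚᵘ.↥ B ℤ.* ℚᵘ.↧ A ≡ + (b ℕ.* Y ℕ.* suc d)
    rhs = begin
      + b ℤ.* (+ c ℤ.* + suc p ℤ.+ (ℤ.- + X) ℤ.* + 1) ℤ.* ℚᵘ.↧ A
        ≡⟨ cong (λ z → + b ℤ.* (z ℤ.+ (ℤ.- + X) ℤ.* + 1) ℤ.* ℚᵘ.↧ A) c·p≡ ⟩
      + b ℤ.* ((+ X ℤ.+ + Y) ℤ.+ (ℤ.- + X) ℤ.* + 1) ℤ.* ℚᵘ.↧ A
        ≡⟨ cancel-X (+ b) (+ X) (+ Y) (ℚᵘ.↧ A) ⟩
      + b ℤ.* + Y ℤ.* ℚᵘ.↧ A
        ≡⟨ cong₂ ℤ._*_ (sym (ℤ.pos-* b Y)) (cong +_ (ℕ.*-identityʳ (suc d))) ⟩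
      + (b ℕ.* Y) ℤ.* + suc d
        ≡⟨ ℤ.pos-* (b ℕ.* Y) (suc d) ⟨
      + (b ℕ.* Y ℕ.* suc d) ∎
      where open ≡-Reasoning

open import Defs
open import Data.Nat using (ℕ; _≤_; _<_; _+_; s≤s; z≤n; >-nonZero)
open import Data.Nat.Properties using (≤-trans)
open import Data.Rational using (ℚ; _*_) renaming (_≤_ to _≤ℚ_; _<_ to _<ℚ_; 0ℚ to 0ℚ)
open import Data.Fin.Subset using (Subset; ∣_∣)
open import Data.Product using (Σ; _×_; ∃)
open import Data.Sum using (_⊎_)
open import Relation.Binary.PropositionalEquality using (_≡_)

open import Data.Nat as ℕ using (suc; _≤?_)
import Data.Nat.Properties as ℕ
open import Data.Vec using (lookup)
open import Data.Product using (_,_)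
open import Data.Sum using (inj₁; inj₂)
open import Relation.Nullary using (yes; no)
open Combinatorics using (many-bad-edges⇒large-excess)
open RationalBounds using (1/suc; 1/suc-positive; 1/suc-*-≤; 1/suc-*-≤-*-minus)

lemma5p6 : (k r : ℕ) → (r≥2 : 2 ≤ r) → r ≤ k →
    Σ ℚ λ c → (0ℚ <ℚ c) ×
      ((n : ℕ) (H : MultiHypergraph k n) (U : Subset n) (b : ℕ) → ∣ U ∣ + b ≡ n →
        (c * ℕ→ℚ (numEdges H) ≤ℚ ℕ→ℚ (edgesMostlyIn H U))
        ⊎ ((0 < b) × ∃ λ (χ : Cut n r) →
             c * ℕ→ℚ (numEdges H)
               ≤ℚ ℕ→ℚ b * excess k r {{>-nonZero (≤-trans (s≤s z≤n) r≥2)}} H χ))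
lemma5p6 k (suc (suc r2)) (s≤s (s≤s z≤n)) r≤k = 1/suc d , 1/suc-positive d , bound
  where
  r1 = suc r2
  r  = suc r1
  P  = r ℕ.^ k
  d  = 4 ℕ.* P ℕ.* r1
  2≤1+d : 2 ≤ suc d
  2≤1+d = s≤s (ℕ.*-mono-≤ {1} {4 ℕ.* P} (ℕ.*-mono-≤ {1} {4} (s≤s z≤n) (ℕ.m^n>0 r k)) (s≤s z≤n))
  bound : (n : ℕ) (H : MultiHypergraph k n) (U : Subset n) (b : ℕ) → ∣ U ∣ + b ≡ n →
    (1/suc d * ℕ→ℚ (numEdges H) ≤ℚ ℕ→ℚ (edgesMostlyIn H U))
    ⊎ ((0 < b) × ∃ λ (χ : Cut n r) → 1/suc d * ℕ→ℚ (numEdges H) ≤ℚ ℕ→ℚ b * excess k r H χ)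
  bound n H U b ∣U∣+b≡n with numEdges H ≤? 2 ℕ.* edgesMostlyIn H U
  ... | yes m≤2·mostly = inj₁ (1/suc-*-≤ d _ _ (≤-trans m≤2·mostly (ℕ.*-monoˡ-≤ (edgesMostlyIn H U) 2≤1+d)))
  ... | no  m≰2·mostly with many-bad-edges⇒large-excess r1 k (s≤s z≤n) r≤k H U b ∣U∣+b≡n (ℕ.≰⇒> m≰2·mostly)
  ...   | b>0 , v , X≤Q , m·P≤ =
    inj₂ (b>0 , lookup v , 1/suc-*-≤-*-minus d (numEdges H) b (cutSize H (lookup v)) _ _ P {{ℕ.m^n≢0 r k}}
                             (ℕ.m+[n∸m]≡n X≤Q) m·P≤)
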